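{- Let $n\ge1$, let $K_n$ be the complete graph on $n$ vertices regarded as a simplicial complex of dimension at most $1$, and let $s>1$. Then $$ps^1\bigl(\Psi_{\zeta_{s,-q}}(K_n)\bigr)(-1)=(-1)^nA_n(q+1)=(-1)^n\sum_{\alpha\vDash n}\binom{n}{\alpha}q^{\,n-\ell(\alpha)}.$$
   Context: Let $\mathbb{K}$ be a field and $F=\mathrm{frac}(\mathbb{K}[q])$. For a simplicial complex $\Gamma$ (faces have dimension $|X|-1$), $\zeta_s(\Gamma)=1$ if $\dim\Gamma<s$ and $0$ otherwise, and $\zeta_{s,q}(\Gamma)=q^{rk(\Gamma^{(1)})}\zeta_s(\Gamma)$, where $\Gamma^{(1)}$ is the 1-skeleton viewed as a graph and $rk$ of a graph is the number of edges of a maximal spanning forest (number of vertices minus number of connected components). $\zeta_{s,-q}$ is obtained by replacing $q$ with $-q$. For $\Gamma$ on vertex set $V$, $|V|=n$: $\Psi_{\zeta_{s,-q}}(\Gamma)=\sum_{\alpha\vDash n}\bigl(\sum_{(V_1,\dots,V_k)}\prod_{j=1}^k\zeta_{s,-q}(\Gamma_{V_j})\bigr)M_\alpha$, the inner sum over ordered set partitions of $V$ with $|V_j|=\alpha_j$, where $\alpha=(\alpha_1,\dots,\alpha_k)$, $\Gamma_T=\{X\cap T:X\in\Gamma\}$, and $M_\alpha$ is the monomial quasi-symmetric function. The principal specialization $ps^1$ is the $F$-linear map sending $M_\alpha$ to the polynomial $\binom{t}{\ell(\alpha)}=t(t-1)\cdots(t-\ell(\alpha)+1)/\ell(\alpha)!$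 in $t$, where $\ell(\alpha)$ is the number of parts of $\alpha$ (equivalently, $x_1=\dots=x_t=1$, $x_i=0$ for $i>t$); $ps^1(g)(-1)$ is its value at $t=-1$. $A_n(q)=\sum_{\omega\in\mathfrak{S}_n}q^{\mathrm{des}(\omega)}$ is the Eulerian polynomial, $\mathrm{des}(\omega)$ the number of descents. $\binom{n}{\alpha}$ is the multinomial coefficient $\binom{n}{\alpha_1,\dots,\alpha_k}$. -}

module Defs where

open import Level using (Level)
open import Data.Bool.Base using (Bool; true; false; _∧_; _∨_; not; if_then_else_)
open import Data.Nat.Base as ℕ using (ℕ; zero; suc; _∸_; _≤ᵇ_; _<ᵇ_; _!; _⊔_)
open import Data.Nat.Properties using (_!≢0)
open import Data.Nat.Combinatorics using (_C_)
open import Data.Integer.Base as ℤ using (ℤ; +_; -[1+_]; _/ℕ_)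
import Data.Integer.Properties as ℤP
open import Data.Fin.Base using (Fin; zero; suc; toℕ)
open import Data.Fin.Properties using () renaming (_≟_ to _≟F_)
open import Data.Fin.Subset using (Subset; inside; outside; _∩_; _∪_; ⁅_⁆; ∣_∣)
open import Data.Vec.Base as Vec using (Vec; []; _∷_; lookup; count)
open import Data.Vec.Properties using (≡-dec)
open import Data.Bool.Properties using () renaming (_≟_ to _≟B_)
open import Data.List.Base as List using (List; []; _∷_; [_]; map; concatMap; foldr; length; allFin; filter)
open import Data.Bool.ListAction using (any; all)
open import Data.Nat.ListAction using () renaming (sum to sumℕ)
open import Data.Nat.Properties using () renaming (_≤?_ to _≤?ℕ_; _≟_ to _≟ℕ_)
open import Data.Product.Base using (_×_; _,_)
open import Relation.Nullary.Decidable using (isYes; does)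
open import Algebra.Bundles using (CommutativeRing)

_≟S_ : ∀ {n} (X Y : Subset n) → _
_≟S_ = ≡-dec _≟B_

allSubsets : (n : ℕ) → List (Subset n)
allSubsets zero    = [ [] ]
allSubsets (suc n) = concatMap (λ X → (outside ∷ X) ∷ (inside ∷ X) ∷ []) (allSubsets n)

allFuns : (k n : ℕ) → List (Vec (Fin k) n)
allFuns k zero    = [ [] ]
allFuns k (suc n) = concatMap (λ f → map (λ j → j ∷ f) (allFin k)) (allFuns k n)

Complex : ℕ → Set
Complex n = List (Subset n)

_∈ᶜ_ : ∀ {n} → Subset n → Complex n → Bool
X ∈ᶜ Γ = any (λ Y → does (X ≟S Y)) Γ

-- dimension: max |X| - 1 over faces X (the complex {∅} has dimension -1)
dim : ∀ {n} → Complex n → ℤ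
dim Γ = + (foldr (λ X m → ∣ X ∣ ⊔ m) 0 Γ) ℤ.- ℤ.1ℤ

restrict : ∀ {n} → Complex n → Subset n → Complex n
restrict Γ T = map (_∩ T) Γ

completeGraph : (n : ℕ) → Complex n
completeGraph n = filter (λ X → ∣ X ∣ ≤?ℕ 2) (allSubsets n)

isVertex : ∀ {n} → Complex n → Fin n → Bool
isVertex Γ v = ⁅ v ⁆ ∈ᶜ Γ

isEdge : ∀ {n} → Complex n → Fin n → Fin n → Bool
isEdge Γ u v = not (does (u ≟F v)) ∧ ((⁅ u ⁆ ∪ ⁅ v ⁆) ∈ᶜ Γ)

reachable : ∀ {n} → Complex n → ℕ → Fin n → Fin n → Bool
reachable Γ zero    u v = does (u ≟F v)
reachable {n} Γ (suc k) u v =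
  reachable Γ k u v ∨ any (λ w → reachable Γ k u w ∧ isEdge Γ w v) (allFin n)

vertices : ∀ {n} → Complex n → List (Fin n)
vertices {n} Γ = filter (λ v → isVertex Γ v ≟B true) (allFin n)

-- number of connected components of Γ^(1): count the vertices that are the
-- least vertex of their component
components : ∀ {n} → Complex n → ℕ
components {n} Γ =
  length (filter (λ v → not (any (λ u → (toℕ u <ᵇ toℕ v) ∧ reachable Γ n u v) (vertices Γ)) ≟B true)
                 (vertices Γ))

-- rk of a graph = #vertices − #components (edges of a maximal spanning forest)
rk1 : ∀ {n} → Complex n → ℕ
rk1 Γ = length (vertices Γ) ∸ components Γ

compositions : ℕ → List (List ℕ)
compositions zero    = [ [] ]
compositions (suc n) = concatMap (λ c → (1 ∷ c) ∷ inc c) (compositions n)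
  where
  inc : List ℕ → List (List ℕ)
  inc []      = []
  inc (a ∷ c) = [ suc a ∷ c ]

multinomial : List ℕ → ℕ
multinomial []      = 1
multinomial (a ∷ c) = (sumℕ (a ∷ c) C a) ℕ.* multinomial c

-- permutations of {0,…,n-1} in one-line notation
insertions : ℕ → List ℕ → List (List ℕ)
insertions x []      = [ x ∷ [] ]
insertions x (y ∷ l) = (x ∷ y ∷ l) ∷ map (y ∷_) (insertions x l)

permutations : ℕ → List (List ℕ)
permutations zero    = [ [] ]
permutations (suc n) = concatMap (insertions n) (permutations n)

des : List ℕ → ℕ
des []          = 0
des (x ∷ [])    = 0
des (x ∷ y ∷ l) = (if y <ᵇ x then 1 else 0) ℕ.+ des (y ∷ l)

falling : ℤ → ℕ → ℤ
falling t zero    = ℤ.1ℤ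
falling t (suc k) = t ℤ.* falling (t ℤ.- ℤ.1ℤ) k

binomℤ : ℤ → ℕ → ℤ
binomℤ t k = (falling t k /ℕ (k !)) {{k !≢0}}

-- Ring-valued part.  The coefficients live in a commutative ring R
-- (the paper's K[q] ⊆ F = frac K[q]), q ∈ R.

module _ {c ℓ : Level} (R : CommutativeRing c ℓ) where
  open CommutativeRing R

  pow : Carrier → ℕ → Carrier
  pow x zero    = 1#
  pow x (suc k) = x * pow x k

  natR : ℕ → Carrier
  natR zero    = 0#
  natR (suc m) = 1# + natR m

  intR : ℤ → Carrier
  intR (+ m)      = natR m
  intR -[1+ m ]   = - natR (suc m)

  sumR : List Carrier → Carrier
  sumR = foldr _+_ 0#

  prodR : List Carrier → Carrier
  prodR = foldr _*_ 1#

  zeta : ℕ → ∀ {n} → Complex n → Carrier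
  zeta s Γ = if does (dim Γ ℤP.<? + s) then 1# else 0#

  zetaq : ℕ → Carrier → ∀ {n} → Complex n → Carrier
  zetaq s q Γ = pow q (rk1 Γ) * zeta s Γ

  zeta-q : ℕ → Carrier → ∀ {n} → Complex n → Carrier
  zeta-q s q Γ = zetaq s (- q) Γ

  -- quasi-symmetric functions of degree n, in the monomial basis:
  -- a formal sum  Σ c_α M_α  given as a list of pairs (α , c_α)
  QSym : Set c
  QSym = List (List ℕ × Carrier)

  -- the j-th block V_j = f⁻¹(j) of an ordered set partition given by f : V → Fin k
  block : ∀ {n k} → Vec (Fin k) n → Fin k → Subset n
  block f j = Vec.map (λ i → does (i ≟F j)) f

  hasType : ∀ {n} (α : List ℕ) → Vec (Fin (length α)) n → Bool
  hasType α f = all (λ j → does (∣ block f j ∣ ≟ℕ List.lookup α j)) (allFin (length α))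

  Ψ : (∀ {n} → Complex n → Carrier) → ∀ {n} → Complex n → QSym
  Ψ ζ {n} Γ = map (λ α → α , coeff α) (compositions n)
    where
    coeff : List ℕ → Carrier
    coeff α = sumR (map (λ f → prodR (map (λ j → ζ (restrict Γ (block f j))) (allFin (length α))))
                        (filter (λ f → hasType α f ≟B true) (allFuns (length α) n)))

  ps1 : QSym → ℤ → Carrier
  ps1 g t = sumR (map (λ { (α , cα) → cα * intR (binomℤ t (length α)) }) g)

  eulerian : ℕ → Carrier → Carrier
  eulerian n x = sumR (map (λ ω → pow x (des ω)) (permutations n))

-- Each block V_j of an ordered set partition of K_n spans a complete graph: its dimension is at
-- most 1 < s and its 1-skeleton is connected, so ζ_{s,-q}(K_n restricted to V_j) = (-q)^(|V_j| - 1).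
-- Hence the coefficient of M_α in Ψ is (n choose α) (-q)^(n - ℓ(α)), and ps¹ at t = -1 multiplies
-- it by binom(-1, ℓ(α)) = (-1)^ℓ(α), giving (-1)^n Σ_α (n choose α) q^(n - ℓ(α)).
--
-- For the Eulerian side put M_n f = Σ_α (n choose α) f(ℓ(α)) and D_n g = Σ_ω g(des ω). Inserting the
-- letter n into permutations gives D_{n+1} g = D_n (d ↦ (d + 1) g(d) + (n - d) g(d + 1)), and splitting
-- compositions by their first part gives M_{n+1} f = M_n (k ↦ k f(k) + (k + 1) f(k + 1)). With these
-- one shows M_n f = D_n (d ↦ Σ_k (d choose n - k) f(k)) by induction on n; for f(k) = q^(n-k) the
-- inner sum is (q + 1)^d by the binomial theorem, so A_n(q + 1) = D_n ((q + 1)^_) = M_n (k ↦ q^(n-k)).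

module Submission where

open import Defs
open import Level using (Level)
open import Data.Nat.Base using (ℕ; _≤_; _<_; _∸_)
open import Data.Integer.Base using (-1ℤ)
open import Data.List.Base using (map; length)
open import Data.Product.Base using (_×_; _,_)
open import Algebra.Bundles using (CommutativeRing)
open import Data.Fin.Subset using (Subset)

module Booleans where
  open import Data.Nat.Base using (_<ᵇ_)
  open import Data.Nat.Properties using (<⇒<ᵇ; <ᵇ⇒<)
  open import Data.Bool.Base using (Bool; true; false)
  open import Data.Bool.Properties using (T-≡; ¬-not; ∧-zeroʳ; ∨-zeroʳ)
  open import Data.Bool.ListAction using (any; all)
  open import Data.List.Base using ([]; _∷_)
  open import Data.List.Membership.Propositional using (_∈_)
  open import Data.List.Relation.Unary.Any using (here; there)
  open import Function.Base using (_∘_)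
  open import Function.Bundles using (Equivalence)
  open import Relation.Nullary using (¬_)
  open import Relation.Binary.PropositionalEquality using (_≡_; refl)

  private
    variable
      a : Level
      A : Set a

  <ᵇ≡true : ∀ {m n} → m < n → (m <ᵇ n) ≡ true
  <ᵇ≡true = Equivalence.to T-≡ ∘ <⇒<ᵇ

  <ᵇ≡false : ∀ {m n} → ¬ m < n → (m <ᵇ n) ≡ false
  <ᵇ≡false {m} {n} m≮n = ¬-not (m≮n ∘ <ᵇ⇒< m n ∘ Equivalence.from T-≡)

  any≡true : ∀ (p : A → Bool) {x} xs → x ∈ xs → p x ≡ true → any p xs ≡ true
  any≡true p (y ∷ xs) (here refl) px rewrite px = refl
  any≡true p (y ∷ xs) (there x∈xs) px rewrite any≡true p xs x∈xs px = ∨-zeroʳ (p y)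

  any≡false : ∀ (p : A → Bool) xs → (∀ x → x ∈ xs → p x ≡ false) → any p xs ≡ false
  any≡false p []       _  = refl
  any≡false p (y ∷ xs) ¬p rewrite ¬p y (here refl) = any≡false p xs (λ x x∈xs → ¬p x (there x∈xs))

  all≡true : ∀ (p : A → Bool) xs → (∀ x → p x ≡ true) → all p xs ≡ true
  all≡true p []       _ = refl
  all≡true p (y ∷ xs) px rewrite px y = all≡true p xs px

  all≡false : ∀ (p : A → Bool) {x} xs → x ∈ xs → p x ≡ false → all p xs ≡ false
  all≡false p (y ∷ xs) (here refl) px rewrite px = refl
  all≡false p (y ∷ xs) (there x∈xs) px rewrite all≡false p xs x∈xs px = ∧-zeroʳ (p y)

  all≡true⇒ : ∀ (p : A → Bool) {x} xs → all p xs ≡ true → x ∈ xs → p x ≡ true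
  all≡true⇒ p (y ∷ xs) all-p (here refl) with p y
  ... | true  = refl
  ... | false = all-p
  all≡true⇒ p (y ∷ xs) all-p (there x∈xs) with p y
  ... | true  = all≡true⇒ p xs all-p x∈xs
  ... | false with () ← all-p

module Pascal where
  open import Data.Nat.Base
  open import Data.Nat.Properties
  open import Data.Nat.Combinatorics using (_C_; nCk+nC[k+1]≡[n+1]C[k+1]; k>n⇒nCk≡0)
  open import Relation.Binary.PropositionalEquality
  open import Data.Nat.Tactic.RingSolver using (solve-∀)

  open ≡-Reasoning

  choose : ℕ → ℕ → ℕ
  choose zero    zero    = 1
  choose zero    (suc k) = 0
  choose (suc n) zero    = 1
  choose (suc n) (suc k) = choose n k + choose n (suc k)

  choose≡C : ∀ n k → choose n k ≡ n C k
  choose≡C zero    zero    = refl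
  choose≡C zero    (suc k) = sym (k>n⇒nCk≡0 {0} {suc k} z<s)
  choose≡C (suc n) zero    = refl
  choose≡C (suc n) (suc k) =
    trans (cong₂ _+_ (choose≡C n k) (choose≡C n (suc k))) (nCk+nC[k+1]≡[n+1]C[k+1] n k)

  choose-n0 : ∀ n → choose n 0 ≡ 1
  choose-n0 zero    = refl
  choose-n0 (suc n) = refl

  choose-< : ∀ {n k} → n < k → choose n k ≡ 0
  choose-< {zero}  {suc k} _         = refl
  choose-< {suc n} {suc k} (s≤s n<k) = cong₂ _+_ (choose-< n<k) (choose-< (m<n⇒m<1+n n<k))

  choose-nn : ∀ n → choose n n ≡ 1
  choose-nn zero    = refl
  choose-nn (suc n) = cong₂ _+_ (choose-nn n) (choose-< (n<1+n n))

  choose-n1 : ∀ n → choose n 1 ≡ n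
  choose-n1 zero    = refl
  choose-n1 (suc n) = cong₂ _+_ (choose-n0 n) (choose-n1 n)

  absorption : ∀ n k → suc k * choose (suc n) (suc k) ≡ suc n * choose n k
  absorption zero    zero    = refl
  absorption zero    (suc k) = *-zeroʳ (suc (suc k))
  absorption (suc n) zero    =
    trans (*-identityˡ _) (trans (choose-n1 (suc (suc n))) (sym (*-identityʳ _)))
  absorption (suc n) (suc k) = begin
    suc (suc k) * (a + b)                           ≡⟨ regroup k a b ⟩
    a + (suc k * a + suc (suc k) * b)              ≡⟨ cong₂ (λ x y → a + (x + y)) (absorption n k) (absorption n (suc k)) ⟩
    a + (suc n * choose n k + suc n * choose n (suc k)) ≡⟨ cong (a +_) (*-distribˡ-+ (suc n) (choose n k) (choose n (suc k))) ⟨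
    a + suc n * a                                   ≡⟨⟩
    suc (suc n) * a                                 ∎
    where
    a b : ℕ
    a = choose (suc n) (suc k)
    b = choose (suc n) (suc (suc k))
    regroup : ∀ k a b → suc (suc k) * (a + b) ≡ a + (suc k * a + suc (suc k) * b)
    regroup = solve-∀

  -- Absorption turns (m + 1) C(d + 1, m + 1) into (d + 1) C(d, m); add it to both sides and cancel.
  weighted-pascal : ∀ {d m k n} → k + m ≡ n → d ≤ n →
    choose d m * k + choose d (suc m) * k ≡ suc d * choose d (suc m) + (n ∸ d) * choose (suc d) (suc m)
  weighted-pascal {d} {m} {k} {n} k+m≡n d≤n = sym (+-cancelʳ-≡ _ _ _ (begin
    (suc d * Q + e * (P + Q)) + suc m * (P + Q) ≡⟨ cong ((suc d * Q + e * (P + Q)) +_) (absorption d m) ⟩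
    (suc d * Q + e * (P + Q)) + suc d * P       ≡⟨ collect (suc d) e P Q ⟩
    (suc d + e) * (P + Q)                       ≡⟨ cong (λ t → suc t * (P + Q)) (trans (m+[n∸m]≡n d≤n) (sym k+m≡n)) ⟩
    (suc (k + m)) * (P + Q)                     ≡⟨ distribute k m P Q ⟩
    (P * k + Q * k) + suc m * (P + Q)           ∎))
    where
    P Q e : ℕ
    P = choose d m
    Q = choose d (suc m)
    e = n ∸ d
    collect : ∀ D e P Q → (D * Q + e * (P + Q)) + D * P ≡ (D + e) * (P + Q)
    collect = solve-∀
    distribute : ∀ k m P Q → suc (k + m) * (P + Q) ≡ (P * k + Q * k) + suc m * (P + Q)
    distribute = solve-∀

module RingSums {c ℓ : Level} (R : CommutativeRing c ℓ) where
  open import Data.Nat.Base as ℕ using (zero; suc; z≤n; s≤s)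
  open import Data.Nat.Properties using (m≤n⇒m≤1+n)
  open import Data.List.Base using (List; []; _∷_; concatMap; _++_)
  open import Data.List.Properties using (map-∘)
  open import Data.List.Relation.Unary.All using (All; []; _∷_)
  import Relation.Binary.PropositionalEquality as ≡
  open Pascal

  open CommutativeRing R public
  open import Relation.Binary.Reasoning.Setoid setoid
  open import Algebra.Solver.Ring.NaturalCoefficients.Default commutativeSemiring
    using (solve; _:+_; _:*_; _:=_; con)

  infixr 8 _^_

  _^_ : Carrier → ℕ → Carrier
  _^_ = pow R

  fromℕ : ℕ → Carrier
  fromℕ = natR R

  sum : List Carrier → Carrier
  sum = sumR R

  fromℕ-1 : fromℕ 1 ≈ 1#
  fromℕ-1 = +-identityʳ 1#

  fromℕ-+ : ∀ m n → fromℕ (m ℕ.+ n) ≈ fromℕ m + fromℕ n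
  fromℕ-+ zero    n = sym (+-identityˡ _)
  fromℕ-+ (suc m) n = trans (+-congˡ (fromℕ-+ m n)) (sym (+-assoc _ _ _))

  fromℕ-* : ∀ m n → fromℕ (m ℕ.* n) ≈ fromℕ m * fromℕ n
  fromℕ-* zero    n = sym (zeroˡ _)
  fromℕ-* (suc m) n = begin
    fromℕ (n ℕ.+ m ℕ.* n)       ≈⟨ fromℕ-+ n (m ℕ.* n) ⟩
    fromℕ n + fromℕ (m ℕ.* n)   ≈⟨ +-congˡ (fromℕ-* m n) ⟩
    fromℕ n + fromℕ m * fromℕ n ≈⟨ solve 2 (λ a b → a :+ b :* a := (con 1 :+ b) :* a) refl (fromℕ n) (fromℕ m) ⟩
    (1# + fromℕ m) * fromℕ n    ∎

  fromℕ-*-assoc : ∀ m n x → fromℕ m * (fromℕ n * x) ≈ fromℕ (m ℕ.* n) * x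
  fromℕ-*-assoc m n x = trans (sym (*-assoc _ _ _)) (*-congʳ (sym (fromℕ-* m n)))

  ^-cong : ∀ {x y} n → x ≈ y → x ^ n ≈ y ^ n
  ^-cong zero    _   = refl
  ^-cong (suc n) x≈y = *-cong x≈y (^-cong n x≈y)

  ^-distribˡ-+-* : ∀ x m n → x ^ (m ℕ.+ n) ≈ x ^ m * x ^ n
  ^-distribˡ-+-* x zero    n = sym (*-identityˡ _)
  ^-distribˡ-+-* x (suc m) n = trans (*-congˡ (^-distribˡ-+-* x m n)) (sym (*-assoc _ _ _))

  ^-distribʳ-* : ∀ x y n → (x * y) ^ n ≈ x ^ n * y ^ n
  ^-distribʳ-* x y zero    = sym (*-identityˡ _)
  ^-distribʳ-* x y (suc n) = trans (*-congˡ (^-distribʳ-* x y n))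
    (solve 4 (λ x y a b → (x :* y) :* (a :* b) := (x :* a) :* (y :* b)) refl x y (x ^ n) (y ^ n))

  private
    variable
      a b : Level
      A B : Set a

  sum-map-++ : ∀ (f : A → Carrier) xs ys → sum (map f (xs ++ ys)) ≈ sum (map f xs) + sum (map f ys)
  sum-map-++ f []       ys = sym (+-identityˡ _)
  sum-map-++ f (x ∷ xs) ys = trans (+-congˡ (sum-map-++ f xs ys)) (sym (+-assoc _ _ _))

  sum-map-cong : ∀ {f g : A → Carrier} xs → (∀ x → f x ≈ g x) → sum (map f xs) ≈ sum (map g xs)
  sum-map-cong []       f≈g = refl
  sum-map-cong (x ∷ xs) f≈g = +-cong (f≈g x) (sum-map-cong xs f≈g)

  sum-map-cong-All : ∀ {p} {P : A → Set p} {f g : A → Carrier} {xs} → All P xs →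
                     (∀ x → P x → f x ≈ g x) → sum (map f xs) ≈ sum (map g xs)
  sum-map-cong-All []         f≈g = refl
  sum-map-cong-All (px ∷ pxs) f≈g = +-cong (f≈g _ px) (sum-map-cong-All pxs f≈g)

  sum-map-+ : ∀ (f g : A → Carrier) xs → sum (map (λ x → f x + g x) xs) ≈ sum (map f xs) + sum (map g xs)
  sum-map-+ f g []       = sym (+-identityˡ _)
  sum-map-+ f g (x ∷ xs) = trans (+-congˡ (sum-map-+ f g xs))
    (solve 4 (λ a b c d → (a :+ b) :+ (c :+ d) := (a :+ c) :+ (b :+ d)) refl (f x) (g x) _ _)

  sum-map-*ˡ : ∀ k (f : A → Carrier) xs → sum (map (λ x → k * f x) xs) ≈ k * sum (map f xs)
  sum-map-*ˡ k f []       = sym (zeroʳ _)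
  sum-map-*ˡ k f (x ∷ xs) = trans (+-congˡ (sum-map-*ˡ k f xs)) (sym (distribˡ _ _ _))

  sum-map-const : ∀ {p} {P : A → Set p} (f : A → Carrier) k {xs} → All P xs →
                  (∀ x → P x → f x ≈ k) → sum (map f xs) ≈ fromℕ (length xs) * k
  sum-map-const f k []         f≈k = sym (zeroˡ _)
  sum-map-const f k {x ∷ xs} (px ∷ pxs) f≈k =
    trans (+-cong (f≈k x px) (sum-map-const f k pxs f≈k))
          (solve 2 (λ k m → k :+ m :* k := (con 1 :+ m) :* k) refl k (fromℕ (length xs)))

  sum-map-map : ∀ (f : B → Carrier) (g : A → B) xs →
                sum (map f (map g xs)) ≡.≡ sum (map (λ x → f (g x)) xs)
  sum-map-map f g xs = ≡.cong sum (≡.sym (map-∘ xs))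

  sum-map-concatMap : ∀ (f : B → Carrier) (h : A → List B) xs →
                      sum (map f (concatMap h xs)) ≈ sum (map (λ x → sum (map f (h x))) xs)
  sum-map-concatMap f h []       = refl
  sum-map-concatMap f h (x ∷ xs) =
    trans (sum-map-++ f (h x) (concatMap h xs)) (+-congˡ (sum-map-concatMap f h xs))

  sumRange : ℕ → (ℕ → Carrier) → Carrier
  sumRange zero    φ = 0#
  sumRange (suc N) φ = φ 0 + sumRange N (λ k → φ (suc k))

  sumRange-cong : ∀ N {φ ψ : ℕ → Carrier} → (∀ k → k < N → φ k ≈ ψ k) → sumRange N φ ≈ sumRange N ψ
  sumRange-cong zero    φ≈ψ = refl
  sumRange-cong (suc N) φ≈ψ = +-cong (φ≈ψ 0 (s≤s z≤n)) (sumRange-cong N (λ k k<N → φ≈ψ (suc k) (s≤s k<N)))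

  sumRange-+ : ∀ N (φ ψ : ℕ → Carrier) → sumRange N (λ k → φ k + ψ k) ≈ sumRange N φ + sumRange N ψ
  sumRange-+ zero    φ ψ = sym (+-identityˡ _)
  sumRange-+ (suc N) φ ψ = trans (+-congˡ (sumRange-+ N _ _))
    (solve 4 (λ a b c d → (a :+ b) :+ (c :+ d) := (a :+ c) :+ (b :+ d)) refl (φ 0) (ψ 0) _ _)

  sumRange-*ˡ : ∀ N a (φ : ℕ → Carrier) → sumRange N (λ k → a * φ k) ≈ a * sumRange N φ
  sumRange-*ˡ zero    a φ = sym (zeroʳ _)
  sumRange-*ˡ (suc N) a φ = trans (+-congˡ (sumRange-*ˡ N a _)) (sym (distribˡ _ _ _))

  sumRange-zero : ∀ N (φ : ℕ → Carrier) → (∀ k → k < N → φ k ≈ 0#) → sumRange N φ ≈ 0#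
  sumRange-zero zero    φ φ≈0 = refl
  sumRange-zero (suc N) φ φ≈0 =
    trans (+-cong (φ≈0 0 (s≤s z≤n)) (sumRange-zero N _ (λ k k<N → φ≈0 (suc k) (s≤s k<N)))) (+-identityˡ _)

  sumRange-snoc : ∀ N (φ : ℕ → Carrier) → sumRange (suc N) φ ≈ sumRange N φ + φ N
  sumRange-snoc zero    φ = trans (+-identityʳ _) (sym (+-identityˡ _))
  sumRange-snoc (suc N) φ = trans (+-congˡ (sumRange-snoc N _)) (sym (+-assoc _ _ _))

  sumRange-reverse : ∀ N (φ : ℕ → Carrier) → sumRange (suc N) (λ k → φ (N ∸ k)) ≈ sumRange (suc N) φ
  sumRange-reverse zero    φ = refl
  sumRange-reverse (suc N) φ = begin
    φ (suc N) + sumRange (suc N) (λ k → φ (N ∸ k)) ≈⟨ +-congˡ (sumRange-reverse N φ) ⟩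
    φ (suc N) + sumRange (suc N) φ                 ≈⟨ +-comm _ _ ⟩
    sumRange (suc N) φ + φ (suc N)                 ≈⟨ sumRange-snoc (suc N) φ ⟨
    sumRange (suc (suc N)) φ                       ∎

  binomial-theorem : ∀ q d N → d ≤ N → sumRange (suc N) (λ j → fromℕ (choose d j) * q ^ j) ≈ (q + 1#) ^ d
  binomial-theorem q zero N _ = begin
    (1# + 0#) * 1# + sumRange N (λ j → 0# * q ^ suc j) ≈⟨ +-cong (trans (*-identityʳ _) (+-identityʳ _))
                                                               (sumRange-zero N _ (λ _ _ → zeroˡ _)) ⟩
    1# + 0#                                           ≈⟨ +-identityʳ _ ⟩
    1#                                                ∎
  binomial-theorem q (suc d) (suc N) (s≤s d≤N) = begin
    c₀ + sumRange (suc N) (λ j → fromℕ (choose d j ℕ.+ choose d (suc j)) * q ^ suc j)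
      ≈⟨ +-congˡ (sumRange-cong (suc N) (λ j _ → pascal-term j)) ⟩
    c₀ + sumRange (suc N) (λ j → q * t j + t (suc j))
      ≈⟨ +-congˡ (trans (sumRange-+ (suc N) (λ j → q * t j) (λ j → t (suc j))) (+-congʳ (sumRange-*ˡ (suc N) q t))) ⟩
    c₀ + (q * sumRange (suc N) t + sumRange (suc N) (λ j → t (suc j)))
      ≈⟨ solve 3 (λ a b c → a :+ (b :+ c) := b :+ (a :+ c)) refl c₀ _ _ ⟩
    q * sumRange (suc N) t + (c₀ + sumRange (suc N) (λ j → t (suc j)))
      ≈⟨ +-congˡ (+-congʳ (*-congʳ (reflexive (≡.cong fromℕ (≡.trans (choose-n0 (suc d)) (≡.sym (choose-n0 d))))))) ⟩
    q * sumRange (suc N) t + sumRange (suc (suc N)) t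
      ≈⟨ +-cong (*-congˡ (binomial-theorem q d N d≤N)) (binomial-theorem q d (suc N) (m≤n⇒m≤1+n d≤N)) ⟩
    q * (q + 1#) ^ d + (q + 1#) ^ d
      ≈⟨ solve 2 (λ q p → q :* p :+ p := (q :+ con 1) :* p) refl q _ ⟩
    (q + 1#) ^ suc d ∎
    where
    t : ℕ → Carrier
    t j = fromℕ (choose d j) * q ^ j
    c₀ : Carrier
    c₀ = fromℕ (choose (suc d) 0) * 1#
    pascal-term : ∀ j → fromℕ (choose d j ℕ.+ choose d (suc j)) * q ^ suc j ≈ q * t j + t (suc j)
    pascal-term j = trans (*-congʳ (fromℕ-+ (choose d j) _)) (trans (distribʳ _ _ _)
      (+-congʳ (solve 3 (λ a q p → a :* (q :* p) := q :* (a :* p)) refl _ q (q ^ j))))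

module Permutations where
  open import Data.Nat.Base using (zero; suc; z≤n; s≤s; _<ᵇ_)
  import Data.Nat.Properties as ℕ
  open import Data.Bool.Base using (true; false)
  open import Data.List.Base using (List; []; _∷_)
  open import Data.List.Relation.Unary.All as All using (All; []; _∷_)
  import Data.List.Relation.Unary.All.Properties as All
  import Relation.Binary.PropositionalEquality as ≡

  open Booleans

  des-≤-length : ∀ z l → des (z ∷ l) ≤ length l
  des-≤-length z []      = z≤n
  des-≤-length z (y ∷ l) with y <ᵇ z
  ... | true  = s≤s (des-≤-length y l)
  ... | false = ℕ.m≤n⇒m≤1+n (des-≤-length y l)

  IsWord : ℕ → List ℕ → Set
  IsWord n ω = All (_< n) ω × length ω ≡.≡ n

  insertions-bounded : ∀ x l → All (_< x) l →
    All (λ w → All (_< suc x) w × length w ≡.≡ suc (length l)) (insertions x l)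
  insertions-bounded x []      []         = (ℕ.n<1+n x ∷ [] , ≡.refl) ∷ []
  insertions-bounded x (y ∷ l) (y<x ∷ l<x) =
    (ℕ.n<1+n x ∷ ℕ.m<n⇒m<1+n y<x ∷ All.map ℕ.m<n⇒m<1+n l<x , ≡.refl) ∷
    All.map⁺ (All.map (λ (w< , len) → (ℕ.m<n⇒m<1+n y<x ∷ w<) , ≡.cong suc len) (insertions-bounded x l l<x))

  permutations-bounded : ∀ n → All (IsWord n) (permutations n)
  permutations-bounded zero    = ([] , ≡.refl) ∷ []
  permutations-bounded (suc n) = All.concat⁺ (All.map⁺ (All.map extend (permutations-bounded n)))
    where
    extend : ∀ {ω} → IsWord n ω → All (IsWord (suc n)) (insertions n ω)
    extend (ω<n , len) = All.map (λ (w< , len′) → w< , ≡.trans len′ (≡.cong suc len)) (insertions-bounded n _ ω<n)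

module EulerianRecurrence {c ℓ : Level} (R : CommutativeRing c ℓ) where
  open import Data.Nat.Base as ℕ using (zero; suc; z≤n; s≤s; _<ᵇ_)
  import Data.Nat.Properties as ℕ
  open import Data.Bool.Base using (Bool; true; false; if_then_else_)
  open import Data.List.Base using ([]; _∷_)
  open import Data.List.Relation.Unary.All using (All; []; _∷_)
  import Relation.Binary.PropositionalEquality as ≡

  open RingSums R
  open Booleans
  open Permutations
  open import Relation.Binary.Reasoning.Setoid setoid
  open import Algebra.Solver.Ring.NaturalCoefficients.Default commutativeSemiring
    using (solve; _:+_; _:*_; _:=_; con)

  descentSum : ℕ → (ℕ → Carrier) → Carrier
  descentSum n g = sum (map (λ ω → g (des ω)) (permutations n))

  -- Inserting n into a permutation of {0,…,n-1} with d descents yields d + 1 permutations with d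
  -- descents and n - d with d + 1 descents.
  descentStep : ℕ → (ℕ → Carrier) → ℕ → Carrier
  descentStep n g d = fromℕ (suc d) * g d + fromℕ (n ∸ d) * g (suc d)

  -- As in des, so that des (y ∷ z ∷ w) reduces to δ (z <ᵇ y) + des (z ∷ w).
  δ : Bool → ℕ
  δ b = if b then 1 else 0

  descentStep-cons : ∀ b D L (g : ℕ → Carrier) → D ≤ L →
    g (suc D) + descentStep L (λ e → g (δ b ℕ.+ e)) D ≈ descentStep (suc L) g (δ b ℕ.+ D)
  descentStep-cons true  D L g _   =
    solve 4 (λ a x b y → a :+ (x :* a :+ y :* b) := (con 1 :+ x) :* a :+ y :* b) refl
      (g (suc D)) (fromℕ (suc D)) (g (suc (suc D))) (fromℕ (L ∸ D))
  descentStep-cons false D L g D≤L = begin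
    g (suc D) + (fromℕ (suc D) * g D + fromℕ (L ∸ D) * g (suc D))
      ≈⟨ solve 4 (λ a x b y → a :+ (x :* b :+ y :* a) := x :* b :+ (con 1 :+ y) :* a) refl
           (g (suc D)) (fromℕ (suc D)) (g D) (fromℕ (L ∸ D)) ⟩
    fromℕ (suc D) * g D + fromℕ (suc (L ∸ D)) * g (suc D)
      ≈⟨ +-congˡ (*-congʳ (reflexive (≡.cong fromℕ (≡.sym (ℕ.+-∸-assoc 1 D≤L))))) ⟩
    fromℕ (suc D) * g D + fromℕ (suc L ∸ D) * g (suc D) ∎

  sum-insertions-after : ∀ {x} y l → y < x → All (_< x) l → ∀ (g : ℕ → Carrier) →
    sum (map (λ w → g (des (y ∷ w))) (insertions x l)) ≈ descentStep (length l) g (des (y ∷ l))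
  sum-insertions-after {x} y [] y<x [] g = begin
    g (δ (x <ᵇ y) ℕ.+ 0) + 0#  ≈⟨ +-congʳ (reflexive (≡.cong (λ b → g (δ b ℕ.+ 0)) (<ᵇ≡false (ℕ.<-asym y<x)))) ⟩
    g 0 + 0#                   ≈⟨ solve 2 (λ a b → a :+ con 0 := (con 1 :+ con 0) :* a :+ con 0 :* b) refl (g 0) (g 1) ⟩
    descentStep 0 g 0          ∎
  sum-insertions-after {x} y (z ∷ l) y<x (z<x ∷ l<x) g = begin
    g (des (y ∷ x ∷ z ∷ l)) + sum (map (λ w → g (des (y ∷ w))) (map (z ∷_) (insertions x l)))
      ≈⟨ +-cong (reflexive (≡.cong g des-front)) (reflexive (sum-map-map (λ w → g (des (y ∷ w))) (z ∷_) (insertions x l))) ⟩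
    g (suc (des (z ∷ l))) + sum (map (λ w → g (δ (z <ᵇ y) ℕ.+ des (z ∷ w))) (insertions x l))
      ≈⟨ +-congˡ (sum-insertions-after z l z<x l<x (λ e → g (δ (z <ᵇ y) ℕ.+ e))) ⟩
    g (suc (des (z ∷ l))) + descentStep (length l) (λ e → g (δ (z <ᵇ y) ℕ.+ e)) (des (z ∷ l))
      ≈⟨ descentStep-cons (z <ᵇ y) (des (z ∷ l)) (length l) g (des-≤-length z l) ⟩
    descentStep (length (z ∷ l)) g (des (y ∷ z ∷ l)) ∎
    where
    des-front : des (y ∷ x ∷ z ∷ l) ≡.≡ suc (des (z ∷ l))
    des-front = ≡.cong₂ ℕ._+_ (≡.cong δ (<ᵇ≡false (ℕ.<-asym y<x)))
                              (≡.cong₂ ℕ._+_ (≡.cong δ (<ᵇ≡true z<x)) ≡.refl)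

  sum-insertions : ∀ {x} l → All (_< x) l → ∀ (g : ℕ → Carrier) →
    sum (map (λ w → g (des w)) (insertions x l)) ≈ descentStep (length l) g (des l)
  sum-insertions [] [] g = solve 2 (λ a b → a :+ con 0 := (con 1 :+ con 0) :* a :+ con 0 :* b) refl (g 0) (g 1)
  sum-insertions {x} (y ∷ l) (y<x ∷ l<x) g = begin
    g (des (x ∷ y ∷ l)) + sum (map (λ w → g (des w)) (map (y ∷_) (insertions x l)))
      ≈⟨ +-cong (reflexive (≡.cong g des-front)) (reflexive (sum-map-map (λ w → g (des w)) (y ∷_) (insertions x l))) ⟩
    g (suc (des (y ∷ l))) + sum (map (λ w → g (des (y ∷ w))) (insertions x l))
      ≈⟨ +-congˡ (sum-insertions-after y l y<x l<x g) ⟩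
    g (suc (des (y ∷ l))) + descentStep (length l) g (des (y ∷ l))
      ≈⟨ descentStep-cons false (des (y ∷ l)) (length l) g (des-≤-length y l) ⟩
    descentStep (length (y ∷ l)) g (des (y ∷ l)) ∎
    where
    des-front : des (x ∷ y ∷ l) ≡.≡ suc (des (y ∷ l))
    des-front = ≡.cong₂ ℕ._+_ (≡.cong δ (<ᵇ≡true y<x)) ≡.refl

  descentSum-suc : ∀ n g → descentSum (suc n) g ≈ descentSum n (descentStep n g)
  descentSum-suc n g = trans (sum-map-concatMap (λ ω → g (des ω)) (insertions n) (permutations n))
    (sum-map-cong-All (permutations-bounded n) (λ ω (ω<n , len) →
      trans (sum-insertions ω ω<n g) (reflexive (≡.cong (λ m → descentStep m g (des ω)) len))))

  descentSum-cong : ∀ n {g h : ℕ → Carrier} → (∀ d → d ≤ n → g d ≈ h d) → descentSum n g ≈ descentSum n h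
  descentSum-cong zero    g≈h = +-congʳ (g≈h 0 z≤n)
  descentSum-cong (suc n) {g} {h} g≈h = begin
    descentSum (suc n) g              ≈⟨ descentSum-suc n g ⟩
    descentSum n (descentStep n g)    ≈⟨ descentSum-cong n (λ d d≤n →
                                           +-cong (*-congˡ {fromℕ (suc d)} (g≈h d (ℕ.m≤n⇒m≤1+n d≤n)))
                                                  (*-congˡ {fromℕ (n ∸ d)} (g≈h (suc d) (s≤s d≤n)))) ⟩
    descentSum n (descentStep n h)    ≈⟨ descentSum-suc n h ⟨
    descentSum (suc n) h              ∎

module CompositionShape where
  open import Data.Nat.Base using (zero; suc; z≤n; s≤s)
  import Data.Nat.Properties as ℕ
  open import Data.Nat.ListAction using () renaming (sum to sumℕ)
  open import Data.List.Base using (List; []; _∷_)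
  open import Data.List.Relation.Unary.All as All using (All; []; _∷_)
  import Data.List.Relation.Unary.All.Properties as All
  import Relation.Binary.PropositionalEquality as ≡

  IsComposition : ℕ → List ℕ → Set
  IsComposition n α = sumℕ α ≡.≡ n × All (1 ≤_) α

  compositions-valid : ∀ n → All (IsComposition n) (compositions n)
  compositions-valid zero    = (≡.refl , []) ∷ []
  compositions-valid (suc n) = All.concat⁺ (All.map⁺ (All.map
    (λ { {[]}    (Σα≡n , α≥1)       → (≡.cong suc Σα≡n , s≤s z≤n ∷ α≥1) ∷ []
       ; {a ∷ α} (Σα≡n , a≥1 ∷ α≥1) → (≡.cong suc Σα≡n , s≤s z≤n ∷ a≥1 ∷ α≥1)
                                     ∷ (≡.cong suc Σα≡n , s≤s z≤n ∷ α≥1) ∷ [] })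
    (compositions-valid n)))

  length≤sum : ∀ {α} → All (1 ≤_) α → length α ≤ sumℕ α
  length≤sum []         = z≤n
  length≤sum (a≥1 ∷ α≥1) = ℕ.+-mono-≤ a≥1 (length≤sum α≥1)

module MultinomialSums {c ℓ : Level} (R : CommutativeRing c ℓ) where
  open import Data.Nat.Base as ℕ using (zero; suc; s≤s)
  import Data.Nat.Properties as ℕ
  open import Data.Nat.Combinatorics using (_C_)
  open import Data.Nat.Induction using (<-rec)
  open import Data.Nat.ListAction using () renaming (sum to sumℕ)
  open import Data.List.Base using (List; []; _∷_)
  open import Data.List.Relation.Unary.All using ([]; _∷_)
  import Relation.Binary.PropositionalEquality as ≡
  open Pascal

  open RingSums R
  open CompositionShape
  open import Relation.Binary.Reasoning.Setoid setoid
  open import Algebra.Solver.Ring.NaturalCoefficients.Default commutativeSemiring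
    using (solve; _:+_; _:*_; _:=_; con)

  multinomialSum : ℕ → (ℕ → Carrier) → Carrier
  multinomialSum n f = sum (map (λ α → fromℕ (multinomial α) * f (length α)) (compositions n))

  -- A composition of n + 1 is 1 ∷ α or, when α = a ∷ β is nonempty, (a + 1) ∷ β, for α ⊨ n.
  bumpHead : (List ℕ → Carrier) → List ℕ → Carrier
  bumpHead φ []      = 0#
  bumpHead φ (a ∷ α) = φ (suc a ∷ α)

  sum-compositions-suc : ∀ n (φ : List ℕ → Carrier) →
    sum (map φ (compositions (suc n))) ≈ sum (map (λ α → φ (1 ∷ α) + bumpHead φ α) (compositions n))
  sum-compositions-suc n φ = trans (sum-map-concatMap φ _ (compositions n)) (sum-map-cong (compositions n)
    (λ { [] → refl ; (a ∷ α) → +-congˡ (+-identityʳ _) }))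

  sum-compositions-by-head : ∀ m (φ : List ℕ → Carrier) → sum (map φ (compositions (suc m))) ≈
    sumRange (suc m) (λ a → sum (map (λ α → φ (suc a ∷ α)) (compositions (m ∸ a))))
  sum-compositions-by-head zero    φ = sum-compositions-suc 0 φ
  sum-compositions-by-head (suc m) φ = trans (sum-compositions-suc (suc m) φ)
    (trans (sum-map-+ (λ α → φ (1 ∷ α)) (bumpHead φ) (compositions (suc m)))
           (+-congˡ (sum-compositions-by-head m (bumpHead φ))))

  multinomialSum-cong : ∀ n {f g : ℕ → Carrier} → (∀ k → f k ≈ g k) → multinomialSum n f ≈ multinomialSum n g
  multinomialSum-cong n f≈g = sum-map-cong (compositions n) (λ α → *-congˡ (f≈g (length α)))

  multinomialSum-+ : ∀ n (f g : ℕ → Carrier) →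
    multinomialSum n (λ k → f k + g k) ≈ multinomialSum n f + multinomialSum n g
  multinomialSum-+ n f g = trans (sum-map-cong (compositions n) (λ α → distribˡ _ _ _))
    (sum-map-+ (λ α → fromℕ (multinomial α) * f (length α)) (λ α → fromℕ (multinomial α) * g (length α)) (compositions n))

  multinomialSum-zero : ∀ f → multinomialSum 0 f ≈ f 0
  multinomialSum-zero f = trans (+-identityʳ _) (trans (*-congʳ fromℕ-1) (*-identityˡ _))

  multinomialSum-by-head : ∀ m f → multinomialSum (suc m) f ≈
    sumRange (suc m) (λ a → fromℕ (choose (suc m) (suc a)) * multinomialSum (m ∸ a) (λ k → f (suc k)))
  multinomialSum-by-head m f = trans (sum-compositions-by-head m _) (sumRange-cong (suc m) λ a a<m+1 →
    trans (sum-map-cong-All (compositions-valid (m ∸ a)) (λ α (Σα≡m-a , _) → term a α (head+tail {a} {α} a<m+1 Σα≡m-a)))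
          (sum-map-*ˡ (fromℕ (choose (suc m) (suc a))) (λ α → fromℕ (multinomial α) * f (suc (length α))) (compositions (m ∸ a))))
    where
    head+tail : ∀ {a α} → a < suc m → sumℕ α ≡.≡ m ∸ a → suc a ℕ.+ sumℕ α ≡.≡ suc m
    head+tail {a} (s≤s a≤m) Σα≡m-a = ≡.trans (≡.cong (suc a ℕ.+_) Σα≡m-a) (≡.cong suc (ℕ.m+[n∸m]≡n a≤m))
    term : ∀ a α → suc a ℕ.+ sumℕ α ≡.≡ suc m →
      fromℕ (multinomial (suc a ∷ α)) * f (suc (length α)) ≈
      fromℕ (choose (suc m) (suc a)) * (fromℕ (multinomial α) * f (suc (length α)))
    term a α total = begin
      fromℕ (((suc a ℕ.+ sumℕ α) C suc a) ℕ.* multinomial α) * f (suc (length α))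
        ≈⟨ *-congʳ (fromℕ-* ((suc a ℕ.+ sumℕ α) C suc a) (multinomial α)) ⟩
      (fromℕ ((suc a ℕ.+ sumℕ α) C suc a) * fromℕ (multinomial α)) * f (suc (length α))
        ≈⟨ *-congʳ (*-congʳ (reflexive (≡.cong fromℕ
             (≡.trans (≡.sym (choose≡C _ (suc a))) (≡.cong (λ t → choose t (suc a)) total))))) ⟩
      (fromℕ (choose (suc m) (suc a)) * fromℕ (multinomial α)) * f (suc (length α))
        ≈⟨ *-assoc _ _ _ ⟩
      fromℕ (choose (suc m) (suc a)) * (fromℕ (multinomial α) * f (suc (length α))) ∎

  multinomialSum-suc-by-head : ∀ n′ f → let n = suc n′; s = λ k → f (suc k) in
    multinomialSum (suc n) f ≈ sumRange n (λ a → fromℕ (choose n (suc a)) *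
      ((multinomialSum (n′ ∸ a) s + multinomialSum (n′ ∸ a) (λ k → s (suc k))) + multinomialSum (n ∸ a) s))
  multinomialSum-suc-by-head n′ f = begin
    multinomialSum (suc n) f
      ≈⟨ multinomialSum-by-head n f ⟩
    sumRange (suc n) (λ a → fromℕ (choose (suc n) (suc a)) * W a)
      ≈⟨ sumRange-cong (suc n) (λ a _ →
           trans (*-congʳ (fromℕ-+ (choose n a) (choose n (suc a)))) (distribʳ (W a) _ _)) ⟩
    sumRange (suc n) (λ a → fromℕ (choose n a) * W a + coef a * W a)
      ≈⟨ sumRange-+ (suc n) (λ a → fromℕ (choose n a) * W a) (λ a → coef a * W a) ⟩
    sumRange (suc n) (λ a → fromℕ (choose n a) * W a) + sumRange (suc n) (λ a → coef a * W a)
      ≈⟨ +-cong lower upper ⟩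
    sumRange n (λ a → coef a * (Y a + Z a)) + sumRange n (λ a → coef a * W a)
      ≈⟨ sumRange-+ n (λ a → coef a * (Y a + Z a)) (λ a → coef a * W a) ⟨
    sumRange n (λ a → coef a * (Y a + Z a) + coef a * W a)
      ≈⟨ sumRange-cong n (λ a _ → distribˡ (coef a) (Y a + Z a) (W a)) ⟨
    sumRange n (λ a → coef a * ((Y a + Z a) + W a)) ∎
    where
    n : ℕ
    n = suc n′
    s : ℕ → Carrier
    s k = f (suc k)
    coef W Y Z : ℕ → Carrier
    coef a = fromℕ (choose n (suc a))
    W a = multinomialSum (n ∸ a) s
    Y a = multinomialSum (n′ ∸ a) s
    Z a = multinomialSum (n′ ∸ a) (λ k → s (suc k))
    -- C(n+1, a+1) = C(n, a) + C(n, a+1); the first sum is reindexed, its a = 0 term expanded by head.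
    lower : sumRange (suc n) (λ a → fromℕ (choose n a) * W a) ≈ sumRange n (λ a → coef a * (Y a + Z a))
    lower = begin
      fromℕ (choose n 0) * W 0 + sumRange n (λ a → coef a * Y a)
        ≈⟨ +-congʳ (trans (*-congʳ (trans (reflexive (≡.cong fromℕ (choose-n0 n))) fromℕ-1))
                          (trans (*-identityˡ _) (multinomialSum-by-head n′ s))) ⟩
      sumRange n (λ a → coef a * Z a) + sumRange n (λ a → coef a * Y a)
        ≈⟨ +-comm _ _ ⟩
      sumRange n (λ a → coef a * Y a) + sumRange n (λ a → coef a * Z a)
        ≈⟨ sumRange-+ n (λ a → coef a * Y a) (λ a → coef a * Z a) ⟨
      sumRange n (λ a → coef a * Y a + coef a * Z a)
        ≈⟨ sumRange-cong n (λ a _ → distribˡ (coef a) (Y a) (Z a)) ⟨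
      sumRange n (λ a → coef a * (Y a + Z a)) ∎
    upper : sumRange (suc n) (λ a → coef a * W a) ≈ sumRange n (λ a → coef a * W a)
    upper = trans (sumRange-snoc n (λ a → coef a * W a)) (trans (+-congˡ (trans
      (*-congʳ (reflexive (≡.cong fromℕ (choose-< (ℕ.n<1+n n))))) (zeroˡ _))) (+-identityʳ _))

  -- multinomialSum n f = Σₖ Sur(n, k) f k, with Sur(n, k) the number of surjections from an n-set
  -- onto a k-set; the recursion Sur(n+1, k) = k Sur(n, k) + k Sur(n, k-1) becomes:
  surjectionStep : (ℕ → Carrier) → ℕ → Carrier
  surjectionStep f k = fromℕ k * f k + fromℕ (suc k) * f (suc k)

  multinomialSum-suc : ∀ n f → multinomialSum (suc n) f ≈ multinomialSum n (surjectionStep f)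
  multinomialSum-suc = <-rec _ step
    where
    step : ∀ n → (∀ {m} → m < n → ∀ f → multinomialSum (suc m) f ≈ multinomialSum m (surjectionStep f)) →
           ∀ f → multinomialSum (suc n) f ≈ multinomialSum n (surjectionStep f)
    step zero    _  f = trans (multinomialSum-by-head 0 f)
      (trans (+-congʳ (*-congˡ (multinomialSum-zero (λ k → f (suc k)))))
             (solve 2 (λ x y → (con 1 :+ con 0) :* x :+ con 0
                           := (con 1 :+ con 0) :* ((con 0 :* y) :+ (con 1 :+ con 0) :* x) :+ con 0) refl (f 1) (f 0)))
    step (suc n′) IH f = begin
      multinomialSum (suc (suc n′)) f
        ≈⟨ multinomialSum-suc-by-head n′ f ⟩
      sumRange (suc n′) (λ a → fromℕ (choose (suc n′) (suc a)) * ((Y a + Z a) + W a))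
        ≈⟨ sumRange-cong (suc n′) (λ a a≤n′ → *-congˡ {fromℕ (choose (suc n′) (suc a))} (tail-step a a≤n′)) ⟨
      sumRange (suc n′) (λ a → fromℕ (choose (suc n′) (suc a)) * multinomialSum (n′ ∸ a) (λ k → surjectionStep f (suc k)))
        ≈⟨ multinomialSum-by-head n′ (surjectionStep f) ⟨
      multinomialSum (suc n′) (surjectionStep f) ∎
      where
      s : ℕ → Carrier
      s k = f (suc k)
      W Y Z : ℕ → Carrier
      W a = multinomialSum (suc n′ ∸ a) s
      Y a = multinomialSum (n′ ∸ a) s
      Z a = multinomialSum (n′ ∸ a) (λ k → s (suc k))
      -- (S f)(k + 1) = (S s) k + s k + s (k + 1), where s = f ∘ suc and S = surjectionStep.
      tail-step : ∀ a → a < suc n′ → multinomialSum (n′ ∸ a) (λ k → surjectionStep f (suc k)) ≈ (Y a + Z a) + W a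
      tail-step a (s≤s a≤n′) = begin
        multinomialSum (n′ ∸ a) (λ k → surjectionStep f (suc k))
          ≈⟨ multinomialSum-cong (n′ ∸ a) (λ k →
               solve 3 (λ K a b → (con 1 :+ K) :* a :+ (con 1 :+ (con 1 :+ K)) :* b
                               := (a :+ b) :+ (K :* a :+ (con 1 :+ K) :* b)) refl (fromℕ k) (s k) (s (suc k))) ⟩
        multinomialSum (n′ ∸ a) (λ k → (s k + s (suc k)) + surjectionStep s k)
          ≈⟨ trans (multinomialSum-+ (n′ ∸ a) (λ k → s k + s (suc k)) (surjectionStep s))
                   (+-congʳ (multinomialSum-+ (n′ ∸ a) s (λ k → s (suc k)))) ⟩
        (Y a + Z a) + multinomialSum (n′ ∸ a) (surjectionStep s)
          ≈⟨ +-congˡ (IH (s≤s (ℕ.m∸n≤m n′ a)) s) ⟨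
        (Y a + Z a) + multinomialSum (suc (n′ ∸ a)) s
          ≈⟨ +-congˡ (reflexive (≡.cong (λ m → multinomialSum m s) (≡.sym (ℕ.+-∸-assoc 1 a≤n′)))) ⟩
        (Y a + Z a) + W a ∎

module EulerianExpansion {c ℓ : Level} (R : CommutativeRing c ℓ) where
  open import Data.Nat.Base as ℕ using (zero; suc; s≤s)
  import Data.Nat.Properties as ℕ
  import Relation.Binary.PropositionalEquality as ≡
  open Pascal

  open RingSums R
  open EulerianRecurrence R
  open MultinomialSums R
  open import Relation.Binary.Reasoning.Setoid setoid

  binomialTransform : ℕ → (ℕ → Carrier) → ℕ → Carrier
  binomialTransform n f d = sumRange (suc n) (λ k → fromℕ (choose d (n ∸ k)) * f k)

  -- The coefficient of f k in descentStep n (binomialTransform (suc n) f) d.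
  transfer : ℕ → ℕ → ℕ → ℕ
  transfer n d k = suc d ℕ.* choose d (suc n ∸ k) ℕ.+ (n ∸ d) ℕ.* choose (suc d) (suc n ∸ k)

  descentStep-binomialTransform : ∀ n f d →
    sumRange (suc (suc n)) (λ k → fromℕ (transfer n d k) * f k) ≈ descentStep n (binomialTransform (suc n) f) d
  descentStep-binomialTransform n f d = begin
    sumRange (suc (suc n)) (λ k → fromℕ (transfer n d k) * f k)
      ≈⟨ sumRange-cong (suc (suc n)) (λ k _ → split k) ⟩
    sumRange (suc (suc n)) (λ k → fromℕ (suc d) * A k + fromℕ (n ∸ d) * B k)
      ≈⟨ sumRange-+ (suc (suc n)) (λ k → fromℕ (suc d) * A k) (λ k → fromℕ (n ∸ d) * B k) ⟩
    sumRange (suc (suc n)) (λ k → fromℕ (suc d) * A k) + sumRange (suc (suc n)) (λ k → fromℕ (n ∸ d) * B k)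
      ≈⟨ +-cong (sumRange-*ˡ (suc (suc n)) (fromℕ (suc d)) A) (sumRange-*ˡ (suc (suc n)) (fromℕ (n ∸ d)) B) ⟩
    descentStep n (binomialTransform (suc n) f) d ∎
    where
    A B : ℕ → Carrier
    A k = fromℕ (choose d (suc n ∸ k)) * f k
    B k = fromℕ (choose (suc d) (suc n ∸ k)) * f k
    split : ∀ k → fromℕ (transfer n d k) * f k ≈ fromℕ (suc d) * A k + fromℕ (n ∸ d) * B k
    split k = trans (*-congʳ (fromℕ-+ (suc d ℕ.* choose d (suc n ∸ k)) ((n ∸ d) ℕ.* choose (suc d) (suc n ∸ k))))
      (trans (distribʳ _ _ _)
      (+-cong (sym (fromℕ-*-assoc (suc d) (choose d (suc n ∸ k)) (f k)))
              (sym (fromℕ-*-assoc (n ∸ d) (choose (suc d) (suc n ∸ k)) (f k)))))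

  binomialTransform-surjectionStep-expanded : ∀ n f d → d ≤ n →
    binomialTransform n (surjectionStep f) d ≈ sumRange (suc (suc n)) (λ k → fromℕ (transfer n d k) * f k)
  binomialTransform-surjectionStep-expanded n f d d≤n = begin
    sumRange (suc n) (λ k → fromℕ (choose d (n ∸ k)) * (fromℕ k * f k + fromℕ (suc k) * f (suc k)))
      ≈⟨ sumRange-cong (suc n) (λ k _ → trans (distribˡ _ _ _)
           (+-cong (fromℕ-*-assoc (choose d (n ∸ k)) k (f k)) (fromℕ-*-assoc (choose d (n ∸ k)) (suc k) (f (suc k))))) ⟩
    sumRange (suc n) (λ k → U k + V (suc k))
      ≈⟨ sumRange-+ (suc n) U (λ k → V (suc k)) ⟩
    sumRange (suc n) U + sumRange (suc n) (λ k → V (suc k))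
      ≈⟨ +-congˡ shift ⟩
    sumRange (suc n) U + (sumRange (suc n) V + V (suc n))
      ≈⟨ sym (+-assoc _ _ _) ⟩
    (sumRange (suc n) U + sumRange (suc n) V) + V (suc n)
      ≈⟨ +-congʳ (sumRange-+ (suc n) U V) ⟨
    sumRange (suc n) (λ k → U k + V k) + V (suc n)
      ≈⟨ +-cong (sumRange-cong (suc n) coefficient) coefficient-top ⟩
    sumRange (suc n) (λ k → fromℕ (transfer n d k) * f k) + fromℕ (transfer n d (suc n)) * f (suc n)
      ≈⟨ sumRange-snoc (suc n) (λ k → fromℕ (transfer n d k) * f k) ⟨
    sumRange (suc (suc n)) (λ k → fromℕ (transfer n d k) * f k) ∎
    where
    U V : ℕ → Carrier
    U k = fromℕ (choose d (n ∸ k) ℕ.* k) * f k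
    V k = fromℕ (choose d (suc n ∸ k) ℕ.* k) * f k
    shift : sumRange (suc n) (λ k → V (suc k)) ≈ sumRange (suc n) V + V (suc n)
    shift = trans (sym (trans (+-congʳ V0≈0) (+-identityˡ _))) (sumRange-snoc (suc n) V)
      where
      V0≈0 : V 0 ≈ 0#
      V0≈0 = trans (*-congʳ (reflexive (≡.cong fromℕ (ℕ.*-zeroʳ (choose d (suc n)))))) (zeroˡ (f 0))
    coefficient : ∀ k → k < suc n → U k + V k ≈ fromℕ (transfer n d k) * f k
    coefficient k (s≤s k≤n) =
      trans (sym (distribʳ _ _ _))
            (*-congʳ (trans (sym (fromℕ-+ (choose d (n ∸ k) ℕ.* k) _)) (reflexive (≡.cong fromℕ (interior k k≤n)))))
      where
      interior : ∀ k → k ≤ n → choose d (n ∸ k) ℕ.* k ℕ.+ choose d (suc n ∸ k) ℕ.* k ≡.≡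
                                 suc d ℕ.* choose d (suc n ∸ k) ℕ.+ (n ∸ d) ℕ.* choose (suc d) (suc n ∸ k)
      interior k k≤n rewrite ℕ.+-∸-assoc 1 k≤n = weighted-pascal (ℕ.m+[n∸m]≡n k≤n) d≤n
    coefficient-top : V (suc n) ≈ fromℕ (transfer n d (suc n)) * f (suc n)
    coefficient-top = *-congʳ (reflexive (≡.cong fromℕ top))
      where
      top : choose d (n ∸ n) ℕ.* suc n ≡.≡ suc d ℕ.* choose d (n ∸ n) ℕ.+ (n ∸ d) ℕ.* choose (suc d) (n ∸ n)
      top rewrite ℕ.n∸n≡0 n | choose-n0 d =
        ≡.trans (ℕ.*-identityˡ (suc n)) (≡.trans (≡.cong suc (≡.sym (ℕ.m+[n∸m]≡n d≤n)))
        (≡.sym (≡.cong₂ ℕ._+_ (ℕ.*-identityʳ (suc d)) (ℕ.*-identityʳ (n ∸ d)))))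

  binomialTransform-surjectionStep : ∀ n f d → d ≤ n →
    binomialTransform n (surjectionStep f) d ≈ descentStep n (binomialTransform (suc n) f) d
  binomialTransform-surjectionStep n f d d≤n =
    trans (binomialTransform-surjectionStep-expanded n f d d≤n) (descentStep-binomialTransform n f d)

  multinomialSum≈descentSum : ∀ n f → multinomialSum n f ≈ descentSum n (binomialTransform n f)
  multinomialSum≈descentSum zero    f = +-congʳ (sym (+-identityʳ _))
  multinomialSum≈descentSum (suc n) f = begin
    multinomialSum (suc n) f                                 ≈⟨ multinomialSum-suc n f ⟩
    multinomialSum n (surjectionStep f)                      ≈⟨ multinomialSum≈descentSum n (surjectionStep f) ⟩
    descentSum n (binomialTransform n (surjectionStep f))    ≈⟨ descentSum-cong n (binomialTransform-surjectionStep n f) ⟩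
    descentSum n (descentStep n (binomialTransform (suc n) f)) ≈⟨ descentSum-suc n (binomialTransform (suc n) f) ⟨
    descentSum (suc n) (binomialTransform (suc n) f)         ∎

  eulerian-expansion : ∀ n q → eulerian R n (q + 1#) ≈ multinomialSum n (λ k → q ^ (n ∸ k))
  eulerian-expansion n q = begin
    descentSum n ((q + 1#) ^_)                           ≈⟨ descentSum-cong n (λ d d≤n → sym (binomial d d≤n)) ⟩
    descentSum n (binomialTransform n (λ k → q ^ (n ∸ k))) ≈⟨ multinomialSum≈descentSum n (λ k → q ^ (n ∸ k)) ⟨
    multinomialSum n (λ k → q ^ (n ∸ k))                 ∎
    where
    binomial : ∀ d → d ≤ n → binomialTransform n (λ k → q ^ (n ∸ k)) d ≈ (q + 1#) ^ d
    binomial d d≤n = trans (sumRange-reverse n (λ j → fromℕ (choose d j) * q ^ j)) (binomial-theorem q d n d≤n)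

module NatListSums where
  open import Data.Nat.Base using (zero; suc; _+_)
  import Data.Nat.Properties as ℕ
  open import Data.Nat.ListAction using () renaming (sum to sumℕ)
  open import Algebra.Properties.Semiring.Sum ℕ.+-*-semiring using (sum; sum-syntax; sum-replicate-zero; ∑-distrib-+)
  open import Data.List.Base using (List; []; _∷_; concatMap; _++_; filter; tabulate)
  open import Data.List.Properties using (map-cong)
  open import Data.Fin.Base using (Fin; zero; suc)
  open import Data.Bool.Base using (Bool; true; false; if_then_else_)
  open import Data.Bool.Properties using () renaming (_≟_ to _≟B_)
  open import Function.Base using (_∘_)
  open import Relation.Binary.PropositionalEquality

  private
    variable
      a : Level
      A B : Set a

  indicator : Bool → ℕ
  indicator b = if b then 1 else 0

  length-filter : ∀ (p : A → Bool) xs → length (filter (λ x → p x ≟B true) xs) ≡ sumℕ (map (indicator ∘ p) xs)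
  length-filter p []       = refl
  length-filter p (x ∷ xs) with p x
  ... | true  = cong suc (length-filter p xs)
  ... | false = length-filter p xs

  sumℕ-map-++ : ∀ (g : A → ℕ) xs ys → sumℕ (map g (xs ++ ys)) ≡ sumℕ (map g xs) + sumℕ (map g ys)
  sumℕ-map-++ g []       ys = refl
  sumℕ-map-++ g (x ∷ xs) ys = trans (cong (g x +_) (sumℕ-map-++ g xs ys)) (sym (ℕ.+-assoc (g x) _ _))

  sumℕ-map-concatMap : ∀ (g : B → ℕ) (h : A → List B) xs →
    sumℕ (map g (concatMap h xs)) ≡ sumℕ (map (λ x → sumℕ (map g (h x))) xs)
  sumℕ-map-concatMap g h []       = refl
  sumℕ-map-concatMap g h (x ∷ xs) =
    trans (sumℕ-map-++ g (h x) (concatMap h xs)) (cong (sumℕ (map g (h x)) +_) (sumℕ-map-concatMap g h xs))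

  sumℕ-map-cong : ∀ {g h : A → ℕ} xs → (∀ x → g x ≡ h x) → sumℕ (map g xs) ≡ sumℕ (map h xs)
  sumℕ-map-cong xs g≡h = cong sumℕ (map-cong g≡h xs)

  sumℕ-map-tabulate : ∀ k (g : A → ℕ) (f : Fin k → A) → sumℕ (map g (tabulate f)) ≡ sum (g ∘ f)
  sumℕ-map-tabulate zero    g f = refl
  sumℕ-map-tabulate (suc k) g f = cong (g (f zero) +_) (sumℕ-map-tabulate k g (f ∘ suc))

  sumℕ-map-∑ : ∀ k (F : A → Fin k → ℕ) xs →
    sumℕ (map (λ x → ∑[ j < k ] F x j) xs) ≡ ∑[ j < k ] sumℕ (map (λ x → F x j) xs)
  sumℕ-map-∑ k F []       = sym (sum-replicate-zero k)
  sumℕ-map-∑ k F (x ∷ xs) = trans (cong (sum (F x) +_) (sumℕ-map-∑ k F xs)) (sym (∑-distrib-+ (F x) _))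

-- block and hasType live in the ring-parametrised part of Defs, hence the (unused) ring parameter.
module OrderedSetPartitions {c ℓ : Level} (R : CommutativeRing c ℓ) where
  open import Data.Nat.Base using (zero; suc; pred; _+_; _*_; z<s)
  import Data.Nat.Properties as ℕ
  open import Data.Nat.Properties using () renaming (_≟_ to _≟ℕ_)
  open import Data.Nat.ListAction using () renaming (sum to sumℕ)
  open import Algebra.Properties.Semiring.Sum ℕ.+-*-semiring using (sum; sum-syntax; sum-cong-≗; sum-replicate-zero; *-distribˡ-sum)
  open import Data.List.Base as List using (List; []; _∷_; concatMap; filter; allFin)
  open import Data.List.Properties using (map-∘; map-cong)
  open import Data.List.Membership.Propositional.Properties using (∈-allFin)
  open import Data.Vec.Base using (Vec; []; _∷_)
  open import Data.Fin.Base using (Fin; zero; suc)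
  open import Data.Fin.Properties using () renaming (_≟_ to _≟F_)
  open import Data.Fin.Subset using (∣_∣)
  open import Data.Bool.Base using (Bool; true; false; if_then_else_)
  open import Data.Bool.Properties using () renaming (_≟_ to _≟B_)
  open import Data.Bool.ListAction using (all)
  open import Function.Base using (_∘_)
  open import Relation.Nullary.Decidable using (does; yes; no)
  open import Relation.Nullary.Negation using (contradiction)
  open import Relation.Binary.PropositionalEquality
  open Pascal

  open NatListSums
  open Booleans

  hasSizes : ∀ {k n} → (Fin k → ℕ) → Vec (Fin k) n → Bool
  hasSizes {k} v f = all (λ j → does (∣ block R f j ∣ ≟ℕ v j)) (allFin k)

  countOfSizes : ∀ k n → (Fin k → ℕ) → ℕ
  countOfSizes k n v = length (filter (λ f → hasSizes v f ≟B true) (allFuns k n))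

  decrementAt : ∀ {k} → (Fin k → ℕ) → Fin k → Fin k → ℕ
  decrementAt v j i = if does (j ≟F i) then pred (v i) else v i

  whenPositive : ℕ → ℕ → ℕ
  whenPositive zero    _ = 0
  whenPositive (suc _) x = x

  hasSizes-cons : ∀ {k n} (v : Fin k → ℕ) j (f : Vec (Fin k) n) {m} → v j ≡ suc m →
                  hasSizes v (j ∷ f) ≡ hasSizes (decrementAt v j) f
  hasSizes-cons {k} v j f vj≡1+m = cong (List.foldr _ true) (map-cong same-size (allFin k))
    where
    same-size : ∀ i → does (∣ does (j ≟F i) ∷ block R f i ∣ ≟ℕ v i) ≡ does (∣ block R f i ∣ ≟ℕ decrementAt v j i)
    same-size i with j ≟F i
    ... | yes refl rewrite vj≡1+m = refl
    ... | no _     = refl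

  hasSizes-cons-zero : ∀ {k n} (v : Fin k → ℕ) j (f : Vec (Fin k) n) → v j ≡ 0 → hasSizes v (j ∷ f) ≡ false
  hasSizes-cons-zero {k} v j f vj≡0 = all≡false _ (allFin k) (∈-allFin j) oversized
    where
    oversized : does (∣ does (j ≟F j) ∷ block R f j ∣ ≟ℕ v j) ≡ false
    oversized with j ≟F j
    ... | yes _ rewrite vj≡0 = refl
    ... | no j≢j = contradiction refl j≢j

  countOfSizes-suc : ∀ k n (v : Fin k → ℕ) →
    countOfSizes k (suc n) v ≡ ∑[ j < k ] whenPositive (v j) (countOfSizes k n (decrementAt v j))
  countOfSizes-suc k n v = begin
    countOfSizes k (suc n) v
      ≡⟨ length-filter (hasSizes v) (allFuns k (suc n)) ⟩
    sumℕ (map (indicator ∘ hasSizes v) (concatMap (λ f → map (_∷ f) (allFin k)) (allFuns k n)))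
      ≡⟨ sumℕ-map-concatMap (indicator ∘ hasSizes v) (λ f → map (_∷ f) (allFin k)) (allFuns k n) ⟩
    sumℕ (map (λ f → sumℕ (map (indicator ∘ hasSizes v) (map (_∷ f) (allFin k)))) (allFuns k n))
      ≡⟨ sumℕ-map-cong (allFuns k n) (λ f → trans (cong sumℕ (sym (map-∘ (allFin k))))
                                                   (sumℕ-map-tabulate k (λ j → indicator (hasSizes v (j ∷ f))) (λ j → j))) ⟩
    sumℕ (map (λ f → ∑[ j < k ] indicator (hasSizes v (j ∷ f))) (allFuns k n))
      ≡⟨ sumℕ-map-∑ k (λ f j → indicator (hasSizes v (j ∷ f))) (allFuns k n) ⟩
    ∑[ j < k ] sumℕ (map (λ f → indicator (hasSizes v (j ∷ f))) (allFuns k n))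
      ≡⟨ sum-cong-≗ by-first-value ⟩
    ∑[ j < k ] whenPositive (v j) (countOfSizes k n (decrementAt v j)) ∎
    where
    open ≡-Reasoning
    by-first-value : ∀ j → sumℕ (map (λ f → indicator (hasSizes v (j ∷ f))) (allFuns k n)) ≡
                           whenPositive (v j) (countOfSizes k n (decrementAt v j))
    by-first-value j with v j in vj
    ... | zero  = trans (sumℕ-map-cong (allFuns k n) (λ f → cong indicator (hasSizes-cons-zero v j f vj)))
                        (zeros (allFuns k n))
      where
      zeros : ∀ {a} {A : Set a} (xs : List A) → sumℕ (map (λ _ → 0) xs) ≡ 0
      zeros []       = refl
      zeros (_ ∷ xs) = zeros xs
    ... | suc m = trans (sumℕ-map-cong (allFuns k n) (λ f → cong indicator (hasSizes-cons v j f vj)))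
                        (sym (length-filter (hasSizes (decrementAt v j)) (allFuns k n)))

  sum-decrementAt : ∀ {k} (v : Fin k → ℕ) j {m} → v j ≡ suc m → suc (sum (decrementAt v j)) ≡ sum v
  sum-decrementAt v zero    vj≡1+m rewrite vj≡1+m = refl
  sum-decrementAt v (suc j) vj≡1+m =
    trans (sym (ℕ.+-suc (v zero) _)) (cong (v zero +_) (sum-decrementAt (v ∘ suc) j vj≡1+m))

  sum≡0⇒ : ∀ {k} (v : Fin k → ℕ) → sum v ≡ 0 → ∀ j → v j ≡ 0
  sum≡0⇒ v Σv≡0 zero    = ℕ.m+n≡0⇒m≡0 (v zero) Σv≡0
  sum≡0⇒ v Σv≡0 (suc j) = sum≡0⇒ (v ∘ suc) (ℕ.m+n≡0⇒n≡0 (v zero) Σv≡0) j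

  multinomialᶠ : ∀ k → (Fin k → ℕ) → ℕ
  multinomialᶠ zero    v = 1
  multinomialᶠ (suc k) v = choose (v zero + sum (v ∘ suc)) (v zero) * multinomialᶠ k (v ∘ suc)

  multinomialᶠ-empty : ∀ k (v : Fin k → ℕ) → sum v ≡ 0 → multinomialᶠ k v ≡ 1
  multinomialᶠ-empty zero    v Σv≡0 = refl
  multinomialᶠ-empty (suc k) v Σv≡0
    rewrite sum≡0⇒ v Σv≡0 zero | ℕ.m+n≡0⇒n≡0 (v zero) Σv≡0
          | multinomialᶠ-empty k (v ∘ suc) (ℕ.m+n≡0⇒n≡0 (v zero) Σv≡0) = refl

  -- Pascal's rule for multinomials, split at the first part a: M is the multinomial of the remaining
  -- parts (which sum to S) and T its own Pascal expansion, equal to M unless S = 0.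
  choose-head-split : ∀ a S M T → 0 < a + S → (S ≡ 0 → M ≡ 1 × T ≡ 0) → (∀ s → S ≡ suc s → M ≡ T) →
    choose (a + S) a * M ≡ whenPositive a (choose (pred a + S) (pred a) * M) + choose (a + pred S) a * T
  choose-head-split (suc a) zero    M T _ empty _ with empty refl
  ... | refl , refl rewrite ℕ.+-identityʳ a | choose-nn a | choose-< (ℕ.n<1+n a) = refl
  choose-head-split zero    (suc s) M T _ _ M≡T rewrite M≡T s refl | choose-n0 (suc s) | choose-n0 s = refl
  choose-head-split (suc a) (suc s) M T _ _ M≡T rewrite M≡T s refl | ℕ.+-suc a s =
    ℕ.*-distribʳ-+ T (choose (suc (a + s)) a) (choose (suc (a + s)) (suc a))

  multinomialᶠ-pascal : ∀ k (v : Fin k → ℕ) {n} → sum v ≡ suc n →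
    multinomialᶠ k v ≡ ∑[ j < k ] whenPositive (v j) (multinomialᶠ k (decrementAt v j))
  multinomialᶠ-pascal (suc k) v Σv≡1+n = begin
    choose (a + sum w) a * multinomialᶠ k w
      ≡⟨ choose-head-split a (sum w) (multinomialᶠ k w) T (subst (0 <_) (sym Σv≡1+n) z<s) empty nonempty ⟩
    head + b * T
      ≡⟨ cong (head +_) (trans (*-distribˡ-sum b (λ j → whenPositive (w j) (multinomialᶠ k (decrementAt w j))))
                                (sum-cong-≗ tail-term)) ⟩
    head + ∑[ j < k ] whenPositive (w j) (choose (a + sum (decrementAt w j)) a * multinomialᶠ k (decrementAt w j)) ∎
    where
    open ≡-Reasoning
    w : Fin k → ℕ
    w = v ∘ suc
    a b head T : ℕ
    a = v zero
    b = choose (a + pred (sum w)) a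
    head = whenPositive a (choose (pred a + sum w) (pred a) * multinomialᶠ k w)
    T = ∑[ j < k ] whenPositive (w j) (multinomialᶠ k (decrementAt w j))
    empty : sum w ≡ 0 → multinomialᶠ k w ≡ 1 × T ≡ 0
    empty Σw≡0 = multinomialᶠ-empty k w Σw≡0 , trans (sum-cong-≗ no-terms) (sum-replicate-zero k)
      where
      no-terms : ∀ j → whenPositive (w j) (multinomialᶠ k (decrementAt w j)) ≡ 0
      no-terms j = cong (λ x → whenPositive x (multinomialᶠ k (decrementAt w j))) (sum≡0⇒ w Σw≡0 j)
    nonempty : ∀ s → sum w ≡ suc s → multinomialᶠ k w ≡ T
    nonempty s Σw≡1+s = multinomialᶠ-pascal k w Σw≡1+s
    tail-term : ∀ j → b * whenPositive (w j) (multinomialᶠ k (decrementAt w j)) ≡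
                      whenPositive (w j) (choose (a + sum (decrementAt w j)) a * multinomialᶠ k (decrementAt w j))
    tail-term j with w j in wj
    ... | zero  = ℕ.*-zeroʳ b
    ... | suc m = cong (λ t → choose (a + t) a * multinomialᶠ k (decrementAt w j)) (cong pred (sym (sum-decrementAt w j wj)))

  countOfSizes≡multinomialᶠ : ∀ k n (v : Fin k → ℕ) → sum v ≡ n → countOfSizes k n v ≡ multinomialᶠ k v
  countOfSizes≡multinomialᶠ k zero    v Σv≡0 =
    trans (length-filter (hasSizes v) (allFuns k 0))
          (trans (cong (λ b → indicator b + 0) fits) (sym (multinomialᶠ-empty k v Σv≡0)))
    where
    fits : hasSizes v [] ≡ true
    fits = all≡true _ (allFin k) (λ j → subst (λ x → does (0 ≟ℕ x) ≡ true) (sym (sum≡0⇒ v Σv≡0 j)) refl)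
  countOfSizes≡multinomialᶠ k (suc n) v Σv≡1+n =
    trans (countOfSizes-suc k n v) (trans (sum-cong-≗ by-first-value) (sym (multinomialᶠ-pascal k v Σv≡1+n)))
    where
    by-first-value : ∀ j → whenPositive (v j) (countOfSizes k n (decrementAt v j)) ≡
                           whenPositive (v j) (multinomialᶠ k (decrementAt v j))
    by-first-value j with v j in vj
    ... | zero  = refl
    ... | suc m = countOfSizes≡multinomialᶠ k n (decrementAt v j)
                    (ℕ.suc-injective (trans (sum-decrementAt v j vj) Σv≡1+n))

  sum-lookup : ∀ (α : List ℕ) → sum (List.lookup α) ≡ sumℕ α
  sum-lookup []      = refl
  sum-lookup (a ∷ α) = cong (a +_) (sum-lookup α)

  multinomial≡multinomialᶠ : ∀ (α : List ℕ) → multinomial α ≡ multinomialᶠ (length α) (List.lookup α)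
  multinomial≡multinomialᶠ []      = refl
  multinomial≡multinomialᶠ (a ∷ α) =
    cong₂ _*_ (trans (sym (choose≡C _ a)) (cong (λ t → choose (a + t) a) (sym (sum-lookup α))))
              (multinomial≡multinomialᶠ α)

  count-ofType : ∀ n (α : List ℕ) → sumℕ α ≡ n →
    length (filter (λ f → hasType R α f ≟B true) (allFuns (length α) n)) ≡ multinomial α
  count-ofType n α Σα≡n = trans (countOfSizes≡multinomialᶠ (length α) n (List.lookup α) (trans (sum-lookup α) Σα≡n))
                                (sym (multinomial≡multinomialᶠ α))

module Subsets where
  open import Data.Nat.Base as ℕ using (suc; z≤n; s≤s)
  import Data.Nat.Properties as ℕ
  open import Algebra.Properties.Semiring.Sum ℕ.+-*-semiring using (sum)
  open import Data.List.Base using ([]; _∷_)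
  open import Data.List.Membership.Propositional using () renaming (_∈_ to _∈ˡ_)
  open import Data.List.Membership.Propositional.Properties using (∈-concatMap⁺)
  open import Data.List.Relation.Unary.Any as Any using (here; there)
  open import Data.Vec.Base as Vec using ([]; _∷_; lookup)
  open import Data.Fin.Subset using (∣_∣; _∩_; _∪_; inside; outside; _⊆_)
  open import Data.Fin.Subset.Properties using (drop-∷-⊆)
  open import Data.Bool.Base using (true; false)
  open import Function.Base using (_∘_)
  open import Relation.Binary.PropositionalEquality

  ∈-allSubsets : ∀ {n} (X : Subset n) → X ∈ˡ allSubsets n
  ∈-allSubsets []      = here refl
  ∈-allSubsets (b ∷ X) = ∈-concatMap⁺ _ (Any.map (extend b) (∈-allSubsets X))
    where
    extend : ∀ b {Y} → X ≡ Y → (b ∷ X) ∈ˡ ((outside ∷ Y) ∷ (inside ∷ Y) ∷ [])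
    extend false refl = here refl
    extend true  refl = there (here refl)

  p⊆q⇒p∩q≡p : ∀ {n} (p q : Subset n) → p ⊆ q → p ∩ q ≡ p
  p⊆q⇒p∩q≡p []            []      _   = refl
  p⊆q⇒p∩q≡p (outside ∷ p) (_ ∷ q) p⊆q = cong (outside ∷_) (p⊆q⇒p∩q≡p p q (drop-∷-⊆ p⊆q))
  p⊆q⇒p∩q≡p (inside ∷ p)  (t ∷ q) p⊆q with p⊆q Vec.here
  ... | Vec.here = cong (inside ∷_) (p⊆q⇒p∩q≡p p q (drop-∷-⊆ p⊆q))

  ∣p∪q∣≤∣p∣+∣q∣ : ∀ {n} (p q : Subset n) → ∣ p ∪ q ∣ ≤ ∣ p ∣ ℕ.+ ∣ q ∣
  ∣p∪q∣≤∣p∣+∣q∣ []            []            = z≤n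
  ∣p∪q∣≤∣p∣+∣q∣ (inside ∷ p)  (inside ∷ q)  =
    s≤s (ℕ.≤-trans (∣p∪q∣≤∣p∣+∣q∣ p q) (ℕ.+-monoʳ-≤ ∣ p ∣ (ℕ.n≤1+n ∣ q ∣)))
  ∣p∪q∣≤∣p∣+∣q∣ (inside ∷ p)  (outside ∷ q) = s≤s (∣p∪q∣≤∣p∣+∣q∣ p q)
  ∣p∪q∣≤∣p∣+∣q∣ (outside ∷ p) (inside ∷ q)  =
    ℕ.≤-trans (s≤s (∣p∪q∣≤∣p∣+∣q∣ p q)) (ℕ.≤-reflexive (sym (ℕ.+-suc ∣ p ∣ ∣ q ∣)))
  ∣p∪q∣≤∣p∣+∣q∣ (outside ∷ p) (outside ∷ q) = ∣p∪q∣≤∣p∣+∣q∣ p q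

  ∣p∣≡∑indicator : ∀ {n} (p : Subset n) → ∣ p ∣ ≡ sum (NatListSums.indicator ∘ lookup p)
  ∣p∣≡∑indicator []            = refl
  ∣p∣≡∑indicator (inside ∷ p)  = cong suc (∣p∣≡∑indicator p)
  ∣p∣≡∑indicator (outside ∷ p) = ∣p∣≡∑indicator p

module Graphs where
  open import Data.Nat.Base as ℕ using (zero; suc)
  import Data.Nat.Properties as ℕ
  open import Data.List.Base using (List; []; _∷_; filter; allFin)
  open import Data.List.Membership.Propositional using () renaming (_∈_ to _∈ˡ_)
  open import Data.List.Membership.Propositional.Properties using (∈-allFin)
  open import Data.List.Relation.Unary.Any using (here; there)
  import Data.List.Relation.Unary.All as All
  open import Data.List.Relation.Unary.AllPairs using (AllPairs; []; _∷_)
  import Data.List.Properties as List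
  open import Data.Fin.Base using (Fin; toℕ)
  open import Data.Fin.Properties using () renaming (_≟_ to _≟F_)
  open import Data.Bool.Base using (Bool; true; _∧_; _∨_; not)
  open import Data.Bool.Properties using (∨-zeroʳ) renaming (_≟_ to _≟B_)
  open import Data.Bool.ListAction using (any)
  open import Relation.Nullary using (¬_; Dec)
  open import Relation.Nullary.Decidable using (dec-true)
  open import Relation.Binary.PropositionalEquality

  open Booleans

  reachable-refl : ∀ {n} (Γ : Complex n) k u → reachable Γ k u u ≡ true
  reachable-refl Γ zero    u = dec-true (u ≟F u) refl
  reachable-refl Γ (suc k) u rewrite reachable-refl Γ k u = refl

  isEdge⇒reachable : ∀ {n} (Γ : Complex n) u v → isEdge Γ u v ≡ true → reachable Γ n u v ≡ true
  isEdge⇒reachable {suc k} Γ u v uv =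
    trans (cong (reachable Γ k u v ∨_) (any≡true (λ w → reachable Γ k u w ∧ isEdge Γ w v) (allFin (suc k)) (∈-allFin u)
                                          (cong₂ _∧_ (reachable-refl Γ k u) uv)))
          (∨-zeroʳ _)

  -- components counts the vertices with no smaller vertex reachable from them; if every pair of
  -- vertices is connected, only the least one qualifies.
  rank-connected : ∀ {n} (r : Fin n → Fin n → Bool) (V : List (Fin n)) → AllPairs (λ u v → toℕ u < toℕ v) V →
    (∀ u v → u ∈ˡ V → v ∈ˡ V → toℕ u < toℕ v → r u v ≡ true) →
    length V ∸ length (filter (λ v → not (any (λ u → (toℕ u ℕ.<ᵇ toℕ v) ∧ r u v) V) ≟B true) V) ≡ length V ∸ 1
  rank-connected r []       _                _         = refl
  rank-connected {n} r (v₀ ∷ V′) (v₀<V′ ∷ _) connected = cong (λ L → suc (length V′) ∸ length L) leaders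
    where
    V : List (Fin n)
    V = v₀ ∷ V′
    leader? : ∀ v → Dec (not (any (λ u → (toℕ u ℕ.<ᵇ toℕ v) ∧ r u v) V) ≡ true)
    leader? v = not (any (λ u → (toℕ u ℕ.<ᵇ toℕ v) ∧ r u v) V) ≟B true
    minimal : ∀ u → u ∈ˡ V → ¬ toℕ u < toℕ v₀
    minimal u (here refl) = ℕ.<-irrefl refl
    minimal u (there u∈V′) = ℕ.<-asym (All.lookup v₀<V′ u∈V′)
    v₀-leads : not (any (λ u → (toℕ u ℕ.<ᵇ toℕ v₀) ∧ r u v₀) V) ≡ true
    v₀-leads = cong not (any≡false _ V (λ u u∈V → cong (_∧ r u v₀) (<ᵇ≡false (minimal u u∈V))))
    others-follow : ∀ {v} → v ∈ˡ V′ → ¬ (not (any (λ u → (toℕ u ℕ.<ᵇ toℕ v) ∧ r u v) V) ≡ true)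
    others-follow {v} v∈V′ leads with () ← trans (sym leads) (cong not (any≡true _ V (here refl)
      (cong₂ _∧_ (<ᵇ≡true (All.lookup v₀<V′ v∈V′)) (connected v₀ v (here refl) (there v∈V′) (All.lookup v₀<V′ v∈V′)))))
    leaders : filter leader? V ≡ v₀ ∷ []
    leaders = trans (List.filter-accept leader? v₀-leads) (cong (v₀ ∷_) (List.filter-none leader? (All.tabulate others-follow)))

module RestrictedCompleteGraph {n : ℕ} (T : Subset n) where
  open import Data.Nat.Base as ℕ using (zero; suc; z≤n; s≤s; _⊔_)
  import Data.Nat.Properties as ℕ
  open import Data.Nat.Properties using () renaming (_≤?_ to _≤?ℕ_)
  open import Data.Nat.ListAction using () renaming (sum to sumℕ)
  open import Algebra.Properties.Semiring.Sum ℕ.+-*-semiring using (sum)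
  open import Data.Integer.Base as ℤ using (+_)
  import Data.Integer.Properties as ℤ
  open import Data.List.Base as List using (List; []; _∷_; allFin)
  open import Data.List.Membership.Propositional using () renaming (_∈_ to _∈ˡ_)
  open import Data.List.Membership.Propositional.Properties using (∈-map⁺; ∈-map⁻; ∈-filter⁺; ∈-filter⁻)
  open import Data.List.Relation.Unary.Any using (here; there)
  open import Data.List.Relation.Unary.AllPairs using (AllPairs)
  import Data.List.Relation.Unary.AllPairs.Properties as AllPairs
  open import Data.Vec.Base as Vec using ([]; _∷_; lookup)
  open import Data.Vec.Properties using (lookup-zipWith; []=⇒lookup; lookup⇒[]=)
  open import Data.Fin.Base using (toℕ)
  open import Data.Fin.Properties using () renaming (_≟_ to _≟F_)
  open import Data.Fin.Subset using (∣_∣; _∩_; _∪_; ⁅_⁆; _∈_; _⊆_)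
  open import Data.Fin.Subset.Properties using (∣⁅x⁆∣≡1; ∣p∩q∣≤∣p∣; x∈⁅x⁆; x∈⁅y⁆⇒x≡y; x∈p∪q⁻)
  open import Data.Bool.Base using (true; false; _∧_)
  open import Data.Bool.Properties using (∧-zeroʳ) renaming (_≟_ to _≟B_)
  open import Data.Product.Base using (∃)
  open import Data.Sum.Base using (inj₁; inj₂)
  open import Function.Base using (_∘_)
  open import Relation.Nullary.Decidable using (does; dec-true; dec-false)
  open import Relation.Binary.PropositionalEquality

  open Booleans
  open NatListSums
  open Subsets
  open Graphs

  Γ : Complex n
  Γ = restrict (completeGraph n) T

  ∈Γ : ∀ X → ∣ X ∣ ≤ 2 → (X ∩ T) ∈ˡ Γ
  ∈Γ X ∣X∣≤2 = ∈-map⁺ (_∩ T) (∈-filter⁺ (λ X → ∣ X ∣ ≤?ℕ 2) (∈-allSubsets X) ∣X∣≤2)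

  ∈Γ⇒ : ∀ Y → Y ∈ˡ Γ → ∃ λ X → ∣ X ∣ ≤ 2 × Y ≡ X ∩ T
  ∈Γ⇒ Y Y∈Γ with ∈-map⁻ (_∩ T) Y∈Γ
  ... | X , X∈K , Y≡X∩T with ∈-filter⁻ (λ X → ∣ X ∣ ≤?ℕ 2) {xs = allSubsets n} X∈K
  ... | _ , ∣X∣≤2 = X , ∣X∣≤2 , Y≡X∩T

  isFace : ∀ X → X ⊆ T → ∣ X ∣ ≤ 2 → (X ∈ᶜ Γ) ≡ true
  isFace X X⊆T ∣X∣≤2 =
    any≡true _ Γ (∈Γ X ∣X∣≤2)
      (subst (λ Y → does (X ≟S Y) ≡ true) (sym (p⊆q⇒p∩q≡p X T X⊆T)) (dec-true (X ≟S X) refl))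

  dim<s : ∀ s → 2 ≤ s → does (dim Γ ℤ.<? + s) ≡ true
  dim<s s 2≤s = dec-true (dim Γ ℤ.<? + s) (size-1<s _ (max≤2 Γ (λ Y Y∈Γ → face≤2 Y Y∈Γ)))
    where
    face≤2 : ∀ Y → Y ∈ˡ Γ → ∣ Y ∣ ≤ 2
    face≤2 Y Y∈Γ with ∈Γ⇒ Y Y∈Γ
    ... | X , ∣X∣≤2 , refl = ℕ.≤-trans (∣p∩q∣≤∣p∣ X T) ∣X∣≤2
    max≤2 : ∀ (L : List (Subset n)) → (∀ Y → Y ∈ˡ L → ∣ Y ∣ ≤ 2) → List.foldr (λ X m → ∣ X ∣ ⊔ m) 0 L ≤ 2
    max≤2 []      _    = z≤n
    max≤2 (Y ∷ L) L≤2 = ℕ.⊔-lub (L≤2 Y (here refl)) (max≤2 L (λ Z Z∈L → L≤2 Z (there Z∈L)))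
    size-1<s : ∀ m → m ≤ 2 → (+ m ℤ.- ℤ.1ℤ) ℤ.< + s
    size-1<s zero                _                 = ℤ.-<+
    size-1<s (suc zero)          _                 = ℤ.+<+ (ℕ.≤-trans (s≤s z≤n) 2≤s)
    size-1<s (suc (suc zero))    _                 = ℤ.+<+ 2≤s
    size-1<s (suc (suc (suc m))) (s≤s (s≤s ()))

  isVertex≡lookup : ∀ v → isVertex Γ v ≡ lookup T v
  isVertex≡lookup v with lookup T v in v∈T
  ... | true  = isFace ⁅ v ⁆ ⁅v⁆⊆T (ℕ.≤-trans (ℕ.≤-reflexive (∣⁅x⁆∣≡1 v)) (s≤s z≤n))
    where
    ⁅v⁆⊆T : ⁅ v ⁆ ⊆ T
    ⁅v⁆⊆T x∈⁅v⁆ = subst (_∈ T) (sym (x∈⁅y⁆⇒x≡y v x∈⁅v⁆)) (lookup⇒[]= v T v∈T)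
  ... | false = any≡false _ Γ (λ Y Y∈Γ → dec-false (⁅ v ⁆ ≟S Y) (not-face Y Y∈Γ))
    where
    not-face : ∀ Y → Y ∈ˡ Γ → ⁅ v ⁆ ≢ Y
    not-face Y Y∈Γ ⁅v⁆≡Y with ∈Γ⇒ Y Y∈Γ
    ... | X , _ , refl with () ← trans (sym ([]=⇒lookup (x∈⁅x⁆ v)))
      (trans (cong (λ Z → lookup Z v) ⁅v⁆≡Y) (trans (lookup-zipWith _∧_ v X T) (trans (cong (lookup X v ∧_) v∈T) (∧-zeroʳ _))))

  isEdge≡true : ∀ u v → u ≢ v → u ∈ T → v ∈ T → isEdge Γ u v ≡ true
  isEdge≡true u v u≢v u∈T v∈T rewrite dec-false (u ≟F v) u≢v =
    isFace (⁅ u ⁆ ∪ ⁅ v ⁆) ⁅u,v⁆⊆T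
      (ℕ.≤-trans (∣p∪q∣≤∣p∣+∣q∣ ⁅ u ⁆ ⁅ v ⁆) (ℕ.≤-reflexive (cong₂ ℕ._+_ (∣⁅x⁆∣≡1 u) (∣⁅x⁆∣≡1 v))))
    where
    ⁅u,v⁆⊆T : ⁅ u ⁆ ∪ ⁅ v ⁆ ⊆ T
    ⁅u,v⁆⊆T x∈⁅u,v⁆ with x∈p∪q⁻ ⁅ u ⁆ ⁅ v ⁆ x∈⁅u,v⁆
    ... | inj₁ x∈⁅u⁆ = subst (_∈ T) (sym (x∈⁅y⁆⇒x≡y u x∈⁅u⁆)) u∈T
    ... | inj₂ x∈⁅v⁆ = subst (_∈ T) (sym (x∈⁅y⁆⇒x≡y v x∈⁅v⁆)) v∈T

  vertex∈T : ∀ v → v ∈ˡ vertices Γ → v ∈ T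
  vertex∈T v v∈V with ∈-filter⁻ (λ v → isVertex Γ v ≟B true) {xs = allFin n} v∈V
  ... | _ , isV = lookup⇒[]= v T (trans (sym (isVertex≡lookup v)) isV)

  #vertices : length (vertices Γ) ≡ ∣ T ∣
  #vertices = begin
    length (vertices Γ)                               ≡⟨ length-filter (isVertex Γ) (allFin n) ⟩
    sumℕ (map (indicator ∘ isVertex Γ) (allFin n))    ≡⟨ sumℕ-map-cong (allFin n) (cong indicator ∘ isVertex≡lookup) ⟩
    sumℕ (map (indicator ∘ lookup T) (allFin n))      ≡⟨ sumℕ-map-tabulate n (indicator ∘ lookup T) (λ v → v) ⟩
    sum (indicator ∘ lookup T)                        ≡⟨ ∣p∣≡∑indicator T ⟨
    ∣ T ∣                                             ∎
    where open ≡-Reasoning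

  vertices-increasing : AllPairs (λ u v → toℕ u < toℕ v) (vertices Γ)
  vertices-increasing = AllPairs.filter⁺ (λ v → isVertex Γ v ≟B true) (AllPairs.tabulate⁺-< (λ i<j → i<j))

  rk1≡∣T∣∸1 : rk1 Γ ≡ ∣ T ∣ ∸ 1
  rk1≡∣T∣∸1 = trans (rank-connected (reachable Γ n) (vertices Γ) vertices-increasing connected) (cong (_∸ 1) #vertices)
    where
    connected : ∀ u v → u ∈ˡ vertices Γ → v ∈ˡ vertices Γ → toℕ u < toℕ v → reachable Γ n u v ≡ true
    connected u v u∈V v∈V u<v =
      isEdge⇒reachable Γ u v
        (isEdge≡true u v (λ u≡v → ℕ.<-irrefl (cong toℕ u≡v) u<v) (vertex∈T u u∈V) (vertex∈T v v∈V))

module BinomialAtMinusOne where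
  open import Data.Nat.Base as ℕ using (zero; suc; _!; NonZero)
  import Data.Nat.Properties as ℕ
  open import Data.Nat.DivMod using (n%n≡0; n/n≡1)
  open import Data.Integer.Base as ℤ using (+_; -[1+_]; _/ℕ_; 1ℤ; _^_)
  import Data.Integer.Properties as ℤ
  open import Data.Integer.Tactic.RingSolver using (solve-∀)
  open import Data.Sum.Base using (_⊎_; inj₁; inj₂)
  open import Relation.Binary.PropositionalEquality

  rising : ℕ → ℕ → ℕ
  rising a zero    = 1
  rising a (suc k) = a ℕ.* rising (suc a) k

  rising-! : ∀ m k → rising (suc m) k ℕ.* m ! ≡ (m ℕ.+ k) !
  rising-! m zero    = trans (ℕ.+-identityʳ _) (cong _! (sym (ℕ.+-identityʳ m)))
  rising-! m (suc k) = begin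
    (suc m ℕ.* rising (suc (suc m)) k) ℕ.* m ! ≡⟨ reassoc (suc m) (rising (suc (suc m)) k) (m !) ⟩
    rising (suc (suc m)) k ℕ.* (suc m ℕ.* m !) ≡⟨ rising-! (suc m) k ⟩
    (suc m ℕ.+ k) !                            ≡⟨ cong _! (sym (ℕ.+-suc m k)) ⟩
    (m ℕ.+ suc k) !                            ∎
    where
    open ≡-Reasoning
    reassoc : ∀ a b c → (a ℕ.* b) ℕ.* c ≡ b ℕ.* (a ℕ.* c)
    reassoc a b c = trans (cong (ℕ._* c) (ℕ.*-comm a b)) (ℕ.*-assoc b a c)

  falling-negative : ∀ m k → falling -[1+ m ] k ≡ -1ℤ ^ k ℤ.* + rising (suc m) k
  falling-negative m zero    = refl
  falling-negative m (suc k) = begin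
    -[1+ m ] ℤ.* falling (-[1+ m ] ℤ.- 1ℤ) k
      ≡⟨ cong (λ t → -[1+ m ] ℤ.* falling -[1+ t ] k) (ℕ.+-identityʳ (suc m)) ⟩
    -[1+ m ] ℤ.* falling -[1+ suc m ] k
      ≡⟨ cong (-[1+ m ] ℤ.*_) (falling-negative (suc m) k) ⟩
    ℤ.- (+ suc m) ℤ.* (-1ℤ ^ k ℤ.* + rising (suc (suc m)) k)
      ≡⟨ sign-out (+ suc m) (-1ℤ ^ k) (+ rising (suc (suc m)) k) ⟩
    -1ℤ ^ suc k ℤ.* (+ suc m ℤ.* + rising (suc (suc m)) k)
      ≡⟨ cong (-1ℤ ^ suc k ℤ.*_) (sym (ℤ.pos-* (suc m) _)) ⟩
    -1ℤ ^ suc k ℤ.* + rising (suc m) (suc k) ∎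
    where
    open ≡-Reasoning
    sign-out : ∀ a s b → ℤ.- a ℤ.* (s ℤ.* b) ≡ (-1ℤ ℤ.* s) ℤ.* (a ℤ.* b)
    sign-out = solve-∀

  -1^k≡±1 : ∀ k → -1ℤ ^ k ≡ 1ℤ ⊎ -1ℤ ^ k ≡ -1ℤ
  -1^k≡±1 zero    = inj₁ refl
  -1^k≡±1 (suc k) with -1^k≡±1 k
  ... | inj₁ eq = inj₂ (cong (-1ℤ ℤ.*_) eq)
  ... | inj₂ eq = inj₁ (cong (-1ℤ ℤ.*_) eq)

  private
    d%d≡0 : ∀ d → suc d ℕ.% suc d ≡ 0
    d%d≡0 d = n%n≡0 (suc d)
    d/d≡1 : ∀ d → suc d ℕ./ suc d ≡ 1
    d/d≡1 d = n/n≡1 (suc d)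
    -d/d≡-1 : ∀ d → (ℤ.- + suc d) /ℕ suc d ≡ -1ℤ
    -d/d≡-1 d rewrite d%d≡0 d | d/d≡1 d = refl

  unit*d/d≡unit : ∀ {s} → s ≡ 1ℤ ⊎ s ≡ -1ℤ → ∀ d .{{_ : NonZero d}} → (s ℤ.* + d) /ℕ d ≡ s
  unit*d/d≡unit (inj₁ refl) (suc d) = cong +_ (trans (cong (ℕ._/ suc d) (ℕ.+-identityʳ (suc d))) (d/d≡1 d))
  unit*d/d≡unit (inj₂ refl) (suc d) = trans (cong (_/ℕ suc d) (ℤ.-1*i≡-i (+ suc d))) (-d/d≡-1 d)

  binomℤ-minusOne : ∀ k → binomℤ -1ℤ k ≡ -1ℤ ^ k
  binomℤ-minusOne k = begin
    (falling -1ℤ k /ℕ k !) {{k ℕ.!≢0}}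
      ≡⟨ cong (λ t → (t /ℕ k !) {{k ℕ.!≢0}}) (trans (falling-negative 0 k) (cong (λ t → -1ℤ ^ k ℤ.* + t) rising-1)) ⟩
    ((-1ℤ ^ k ℤ.* + (k !)) /ℕ k !) {{k ℕ.!≢0}}
      ≡⟨ unit*d/d≡unit (-1^k≡±1 k) (k !) {{k ℕ.!≢0}} ⟩
    -1ℤ ^ k ∎
    where
    open ≡-Reasoning
    rising-1 : rising 1 k ≡ k !
    rising-1 = trans (sym (ℕ.*-identityʳ _)) (rising-! 0 k)

module PsiOfCompleteGraph {c ℓ : Level} (R : CommutativeRing c ℓ) where
  open import Data.Nat.Base as ℕ using (zero; suc)
  import Data.Nat.Properties as ℕ
  open import Data.Nat.ListAction using () renaming (sum to sumℕ)
  open import Data.Integer.Base as ℤ using (+_; -[1+_])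
  import Data.Integer.Properties as ℤ
  open import Data.List.Base as List using (List; []; _∷_; filter; allFin; tabulate)
  open import Data.List.Properties using (map-tabulate)
  open import Data.List.Membership.Propositional.Properties using (∈-allFin)
  open import Data.List.Relation.Unary.All using (All; []; _∷_)
  import Data.List.Relation.Unary.All.Properties as All
  open import Data.Fin.Base using () renaming (suc to fsuc)
  open import Data.Fin.Subset using (∣_∣)
  open import Data.Bool.Base using (T; true; if_then_else_)
  open import Data.Bool.Properties using () renaming (_≟_ to _≟B_)
  import Relation.Binary.PropositionalEquality as ≡

  open RingSums R
  open CompositionShape
  open MultinomialSums R using (multinomialSum)
  open OrderedSetPartitions R using (count-ofType)
  open Booleans using (all≡true⇒)
  open BinomialAtMinusOne using (binomℤ-minusOne)
  open import Relation.Binary.Reasoning.Setoid setoid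
  open import Algebra.Properties.Ring ring using (-1*x≈-x; -0#≈0#; -‿involutive)
  open import Algebra.Solver.Ring.NaturalCoefficients.Default commutativeSemiring
    using (solve; _:*_; _:=_)

  prod : List Carrier → Carrier
  prod = prodR R

  prod-map-cong : ∀ {a} {A : Set a} {f g : A → Carrier} xs → (∀ x → f x ≈ g x) → prod (map f xs) ≈ prod (map g xs)
  prod-map-cong []       f≈g = refl
  prod-map-cong (x ∷ xs) f≈g = *-cong (f≈g x) (prod-map-cong xs f≈g)

  intR-neg : ∀ z → intR R (ℤ.- z) ≈ - intR R z
  intR-neg (+ zero)  = sym -0#≈0#
  intR-neg (+ suc n) = refl
  intR-neg -[1+ n ]  = sym (-‿involutive _)

  intR-minusOne^ : ∀ k → intR R (-1ℤ ℤ.^ k) ≈ (- 1#) ^ k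
  intR-minusOne^ zero    = fromℕ-1
  intR-minusOne^ (suc k) = begin
    intR R (-1ℤ ℤ.* -1ℤ ℤ.^ k)  ≡⟨ ≡.cong (intR R) (ℤ.-1*i≡-i (-1ℤ ℤ.^ k)) ⟩
    intR R (ℤ.- (-1ℤ ℤ.^ k))    ≈⟨ intR-neg (-1ℤ ℤ.^ k) ⟩
    - intR R (-1ℤ ℤ.^ k)        ≈⟨ -‿cong (intR-minusOne^ k) ⟩
    - ((- 1#) ^ k)              ≈⟨ -1*x≈-x _ ⟨
    (- 1#) ^ suc k              ∎

  -x^m : ∀ x m → (- x) ^ m ≈ (- 1#) ^ m * x ^ m
  -x^m x m = trans (^-cong m (sym (-1*x≈-x x))) (^-distribʳ-* (- 1#) x m)

  prod-blocks : ∀ x {α} → All (1 ≤_) α →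
    prod (map (λ j → x ^ (List.lookup α j ∸ 1)) (allFin (length α))) ≈ x ^ (sumℕ α ∸ length α)
  prod-blocks x []                        = refl
  prod-blocks x {suc a ∷ α} (_ ∷ α≥1) = begin
    x ^ a * prod (map (λ j → x ^ (List.lookup (suc a ∷ α) j ∸ 1)) (tabulate fsuc))
      ≈⟨ *-congˡ (reflexive (≡.cong prod (≡.trans (map-tabulate fsuc (λ j → x ^ (List.lookup (suc a ∷ α) j ∸ 1)))
                                                  (≡.sym (map-tabulate (λ i → i) (λ j → x ^ (List.lookup α j ∸ 1))))))) ⟩
    x ^ a * prod (map (λ j → x ^ (List.lookup α j ∸ 1)) (allFin (length α)))
      ≈⟨ *-congˡ (prod-blocks x α≥1) ⟩
    x ^ a * x ^ (sumℕ α ∸ length α)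
      ≈⟨ ^-distribˡ-+-* x a _ ⟨
    x ^ (a ℕ.+ (sumℕ α ∸ length α))
      ≡⟨ ≡.cong (x ^_) (≡.sym (ℕ.+-∸-assoc a (length≤sum α≥1))) ⟩
    x ^ (a ℕ.+ sumℕ α ∸ length α) ∎

  zeta-restriction : ∀ q s → 2 ≤ s → ∀ {n} (T : Subset n) →
    zeta-q R s q (restrict (completeGraph n) T) ≈ (- q) ^ (∣ T ∣ ∸ 1)
  zeta-restriction q s 2≤s T = trans
    (*-cong (reflexive (≡.cong ((- q) ^_) (RestrictedCompleteGraph.rk1≡∣T∣∸1 T)))
            (reflexive (≡.cong (λ b → if b then 1# else 0#) (RestrictedCompleteGraph.dim<s T s 2≤s))))
    (*-identityʳ _)

  Ψ-coefficient : ∀ q s → 2 ≤ s → ∀ n α → IsComposition n α →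
    sum (map (λ f → prod (map (λ j → zeta-q R s q (restrict (completeGraph n) (block R f j))) (allFin (length α))))
             (filter (λ f → hasType R α f ≟B true) (allFuns (length α) n)))
    ≈ fromℕ (multinomial α) * (- q) ^ (n ∸ length α)
  Ψ-coefficient q s 2≤s n α (Σα≡n , α≥1) = trans
    (sum-map-const _ ((- q) ^ (n ∸ length α)) (All.all-filter (λ f → hasType R α f ≟B true) (allFuns (length α) n)) term)
    (*-congʳ (reflexive (≡.cong fromℕ (count-ofType n α Σα≡n))))
    where
    size : ∀ f j → hasType R α f ≡.≡ true → ∣ block R f j ∣ ≡.≡ List.lookup α j
    size f j typed = ℕ.≡ᵇ⇒≡ _ _ (≡.subst T (≡.sym (all≡true⇒ _ (allFin (length α)) typed (∈-allFin j))) _)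
    term : ∀ f → hasType R α f ≡.≡ true →
      prod (map (λ j → zeta-q R s q (restrict (completeGraph n) (block R f j))) (allFin (length α))) ≈ (- q) ^ (n ∸ length α)
    term f typed = begin
      prod (map (λ j → zeta-q R s q (restrict (completeGraph n) (block R f j))) (allFin (length α)))
        ≈⟨ prod-map-cong (allFin (length α)) (λ j → trans (zeta-restriction q s 2≤s (block R f j))
             (reflexive (≡.cong (λ m → (- q) ^ (m ∸ 1)) (size f j typed)))) ⟩
      prod (map (λ j → (- q) ^ (List.lookup α j ∸ 1)) (allFin (length α)))
        ≈⟨ prod-blocks (- q) α≥1 ⟩
      (- q) ^ (sumℕ α ∸ length α)
        ≡⟨ ≡.cong (λ m → (- q) ^ (m ∸ length α)) Σα≡n ⟩
      (- q) ^ (n ∸ length α) ∎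

  ps1-Ψ-completeGraph : ∀ q n s → 1 < s →
    ps1 R (Ψ R (zeta-q R s q) (completeGraph n)) -1ℤ ≈ (- 1#) ^ n * multinomialSum n (λ k → q ^ (n ∸ k))
  ps1-Ψ-completeGraph q n s 1<s = begin
    ps1 R (Ψ R (zeta-q R s q) (completeGraph n)) -1ℤ
      ≡⟨ sum-map-map _ _ (compositions n) ⟩
    _ ≈⟨ sum-map-cong-All (compositions-valid n) term ⟩
    sum (map (λ α → (- 1#) ^ n * (fromℕ (multinomial α) * q ^ (n ∸ length α))) (compositions n))
      ≈⟨ sum-map-*ˡ ((- 1#) ^ n) (λ α → fromℕ (multinomial α) * q ^ (n ∸ length α)) (compositions n) ⟩
    (- 1#) ^ n * multinomialSum n (λ k → q ^ (n ∸ k)) ∎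
    where
    term : ∀ α → IsComposition n α →
      sum (map (λ f → prod (map (λ j → zeta-q R s q (restrict (completeGraph n) (block R f j))) (allFin (length α))))
               (filter (λ f → hasType R α f ≟B true) (allFuns (length α) n))) * intR R (binomℤ -1ℤ (length α))
      ≈ (- 1#) ^ n * (fromℕ (multinomial α) * q ^ (n ∸ length α))
    term α α⊨n@(Σα≡n , α≥1) = begin
      _ ≈⟨ *-cong (Ψ-coefficient q s 1<s n α α⊨n)
                  (trans (reflexive (≡.cong (intR R) (binomℤ-minusOne (length α)))) (intR-minusOne^ (length α))) ⟩
      (fromℕ (multinomial α) * (- q) ^ (n ∸ len)) * (- 1#) ^ len
        ≈⟨ *-congʳ (*-congˡ (-x^m q (n ∸ len))) ⟩
      (fromℕ (multinomial α) * ((- 1#) ^ (n ∸ len) * q ^ (n ∸ len))) * (- 1#) ^ len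
        ≈⟨ solve 4 (λ M A B C → (M :* (A :* C)) :* B := (A :* B) :* (M :* C)) refl
             (fromℕ (multinomial α)) ((- 1#) ^ (n ∸ len)) ((- 1#) ^ len) (q ^ (n ∸ len)) ⟩
      ((- 1#) ^ (n ∸ len) * (- 1#) ^ len) * (fromℕ (multinomial α) * q ^ (n ∸ len))
        ≈⟨ *-congʳ (^-distribˡ-+-* (- 1#) (n ∸ len) len) ⟨
      (- 1#) ^ (n ∸ len ℕ.+ len) * (fromℕ (multinomial α) * q ^ (n ∸ len))
        ≡⟨ ≡.cong (λ m → (- 1#) ^ m * (fromℕ (multinomial α) * q ^ (n ∸ len)))
                  (ℕ.m∸n+n≡m (≡.subst (len ≤_) Σα≡n (length≤sum α≥1))) ⟩
      (- 1#) ^ n * (fromℕ (multinomial α) * q ^ (n ∸ len)) ∎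
      where
      len : ℕ
      len = length α

proposition5p1 : ∀ {c ℓ : Level} (R : CommutativeRing c ℓ) (q : CommutativeRing.Carrier R)
    (n s : ℕ) → 1 ≤ n → 1 < s →
    let open CommutativeRing R in
    (ps1 R (Ψ R (zeta-q R s q) (completeGraph n)) -1ℤ
       ≈ pow R (- 1#) n * eulerian R n (q + 1#))
    × (pow R (- 1#) n * eulerian R n (q + 1#)
       ≈ pow R (- 1#) n * sumR R (map (λ α → natR R (multinomial α) * pow R q (n ∸ length α)) (compositions n)))
proposition5p1 R q n s _ 1<s =
  trans (ps1-Ψ-completeGraph q n s 1<s) (*-congˡ (sym (eulerian-expansion n q))) , *-congˡ (eulerian-expansion n q)
  where
  open CommutativeRing R
  open EulerianExpansion R using (eulerian-expansion)
  open PsiOfCompleteGraph R using (ps1-Ψ-completeGraph)
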